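{- Let $t$ and $r$ be positive integers. For every sufficiently large $n$, there is an almost $(r-1)$-regular $n$-vertex graph $G$ with $\mathrm{ex}(n,M_t,S_r)=\mathcal{N}(M_t,G)$. Moreover, there is a constant $c>0$ (not depending on $n$) such that for sufficiently large $n$, if an $n$-vertex $S_r$-free graph $G'$ is not almost $(r-1)$-regular, then $\mathcal{N}(M_t,G')\le \mathrm{ex}(n,M_t,S_r)-c\,n^{t-1}$.
   Context: $S_r$ denotes the star $K_{1,r}$ with $r$ leaves. A graph is almost $d$-regular if either every vertex has degree $d$, or all but one vertex have degree $d$ and the remaining vertex has degree $d-1$. $\mathcal{N}(H,G)$ is the number of subgraphs of $G$ isomorphic to $H$; $\mathrm{ex}(n,H,F)$ is the maximum of $\mathcal{N}(H,G)$ over $n$-vertex $F$-free graphs $G$. $M_t$ is the matching with $t$ pairwise vertex-disjoint edges. -}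

module Defs where

open import Data.Bool using (Bool; true; false; _∧_; not; T)
open import Data.Nat using (ℕ; zero; suc; _+_; _*_; _∸_; _^_; _≤_; _<ᵇ_)
open import Data.Fin using (Fin; toℕ)
open import Data.Fin.Properties using (_≟_)
open import Data.List using (List; []; _∷_; length; map; filterᵇ; concatMap; allFin; _++_)
open import Data.Product using (Σ; ∃; ∃-syntax; _×_; _,_; proj₁; proj₂)
open import Data.Sum using (_⊎_)
open import Relation.Binary.PropositionalEquality using (_≡_; _≢_)
open import Relation.Nullary using (¬_; does)
open import Function.Definitions using (Injective)

record Graph (n : ℕ) : Set where
  field
    adj   : Fin n → Fin n → Bool
    sym   : ∀ i j → adj i j ≡ adj j i
    irref : ∀ i → adj i i ≡ false
open Graph public

deg : ∀ {n} → Graph n → Fin n → ℕ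
deg {n} G v = length (filterᵇ (adj G v) (allFin n))

AlmostRegular : ∀ {n} → Graph n → ℕ → Set
AlmostRegular {n} G d =
  (∀ v → deg G v ≡ d)
  ⊎ (∃[ u ] (deg G u + 1 ≡ d × (∀ v → v ≢ u → deg G v ≡ d)))

ContainsStar : ∀ {n} → ℕ → Graph n → Set
ContainsStar {n} r G =
  ∃[ v ] Σ (Fin r → Fin n) λ f → Injective _≡_ _≡_ f × (∀ i → T (adj G v (f i)))

StarFree : ∀ {n} → ℕ → Graph n → Set
StarFree r G = ¬ ContainsStar r G

edges : ∀ {n} → Graph n → List (Fin n × Fin n)
edges {n} G =
  filterᵇ (λ p → (toℕ (proj₁ p) <ᵇ toℕ (proj₂ p)) ∧ adj G (proj₁ p) (proj₂ p))
    (concatMap (λ i → map (λ j → (i , j)) (allFin n)) (allFin n))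

-- all sublists of length k (k-element subsets of a list of distinct items)
choose : ∀ {A : Set} → ℕ → List A → List (List A)
choose zero    xs       = [] ∷ []
choose (suc k) []       = []
choose (suc k) (x ∷ xs) = map (x ∷_) (choose k xs) ++ choose (suc k) xs

eqᵇ : ∀ {n} → Fin n → Fin n → Bool
eqᵇ a b = does (a ≟ b)

disjointEdges : ∀ {n} → Fin n × Fin n → Fin n × Fin n → Bool
disjointEdges (a , b) (c , d) =
  not (eqᵇ a c) ∧ not (eqᵇ a d) ∧ not (eqᵇ b c) ∧ not (eqᵇ b d)

allᵇ : ∀ {A : Set} → (A → Bool) → List A → Bool
allᵇ p []       = true
allᵇ p (x ∷ xs) = p x ∧ allᵇ p xs

pairwiseDisjoint : ∀ {n} → List (Fin n × Fin n) → Bool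
pairwiseDisjoint []       = true
pairwiseDisjoint (e ∷ es) = allᵇ (disjointEdges e) es ∧ pairwiseDisjoint es

-- 𝒩(M_t, G): number of subgraphs of G isomorphic to M_t, i.e. the number
-- of t-element sets of pairwise vertex-disjoint edges of G.
countM : ∀ {n} → ℕ → Graph n → ℕ
countM t G = length (filterᵇ pairwiseDisjoint (choose t (edges G)))

IsEx : ℕ → ℕ → ℕ → ℕ → Set
IsEx n t r m =
  (Σ (Graph n) λ G → (StarFree r G × countM t G ≡ m))
  × (∀ (G : Graph n) → StarFree r G → countM t G ≤ m)

-- Being S_r-free means having maximum degree at most D = r - 1; let s = t - 1.  Let G
-- have maximum degree D, n ≥ N₀ vertices, and not be almost D-regular.  We build H of
-- maximum degree D with K·𝒩(M_t, G) + n^s ≤ K·𝒩(M_t, H).  While two non-adjacent vertices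
-- have degree below D, join them; once the graph is almost regular it has about nD/2
-- edges, and a greedy count shows that the last added edge lies in at least b^s
-- t-matchings, where b = ⌊n/M⌋ for a constant M and n^s ≤ K·b^s.  Otherwise the deficient
-- vertices are pairwise adjacent, which again forces about nD/2 edges.  Take deficient
-- u, v (u = v if its deficit is at least 2) and an edge xy far from both, and replace xy
-- by vy and ux: the t-matchings through xy that avoid u survive through ux, the
-- O(n^(s-1)) through u are lost, and at least b^s new ones pass through vy.  This gives
-- the stability bound; applied to an extremal graph, which exists because there are
-- finitely many graphs on n vertices, it shows that the extremal graph is almost regular.

module Submission where

open import Defs hiding (sym)

open import Algebra.Properties.CommutativeSemigroup using (interchange)
open import Data.Bool using (Bool; true; false; _∧_; _∨_; not; T; if_then_else_)
open import Data.Bool.Properties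
  using ( ∧-comm; ∧-assoc; ∧-zeroʳ; ∧-identityʳ; ∧-idem; ∨-comm; ∨-zeroʳ; ∨-identityʳ
        ; ∧-conicalˡ; ∧-conicalʳ; ∨-conicalˡ; ∨-conicalʳ; T-≡ )
  renaming (_≟_ to _≟ᵇ_)
open import Data.List using (List; []; _∷_; _++_; length; map; filterᵇ; tabulate; allFin; concatMap; lookup)
open import Data.List.Membership.Propositional using (_∈_)
open import Data.List.Membership.Propositional.Properties using (∈-lookup; ∈-filter⁺; ∈-filter⁻; ∈-allFin)
import Data.List.Relation.Unary.All as All
open import Data.List.Relation.Unary.Any using (index)
open import Data.List.Relation.Unary.Any.Properties using (lookup-index)
open import Data.List.Relation.Unary.AllPairs using (_∷_)
open import Data.List.Relation.Unary.Unique.Propositional using (Unique)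
import Data.List.Relation.Unary.Unique.Propositional.Properties as Unique
open import Data.List.Properties using (length-++; length-++-sucʳ; filter-++; length-filter)
open import Data.List.Relation.Binary.Sublist.Propositional using (_⊆_; []; _∷_; _∷ʳ_; ⊆-refl; ⊆-trans)
open import Data.List.Relation.Binary.Sublist.Propositional.Properties using (filter⁺; filter-⊆; length-mono-≤; ++⁺)
open import Data.Empty using (⊥; ⊥-elim)
open import Data.Fin using (Fin; zero; suc; toℕ; inject≤)
open import Data.Fin.Properties using (_≟_; toℕ-injective; any?; all?; inject≤-injective; injective⇒≤)
open import Data.Nat using (ℕ; zero; suc; _+_; _*_; _∸_; _^_; _/_; _%_; _≤_; _<_; _<ᵇ_; _≤?_; _<?_; z≤n; s≤s)
open import Data.Nat.DivMod using (m≡m%n+[m/n]*n; m%n<n; m/n*n≤m)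
open import Data.Nat.Properties renaming (_≟_ to _≟ℕ_)
open import Data.Nat.Tactic.RingSolver using (solve-∀)
open import Algebra.Properties.Semiring.Sum +-*-semiring
  using (sum; sum-syntax; ∑-distrib-+; ∑-comm; sum-cong-≗; *-distribˡ-sum)
open import Data.Product using (Σ; Σ-syntax; ∃-syntax; _×_; _,_; proj₁; proj₂)
open import Data.Sum using (_⊎_; inj₁; inj₂)
open import Data.Vec.Functional using () renaming (_∷_ to _∷ᶠ_)
open import Function using (_∘_; id)
open import Function.Bundles using (Equivalence)
open import Function.Definitions using (Injective)
open import Relation.Binary.Definitions using (tri<; tri≈; tri>)
open import Relation.Binary.PropositionalEquality
open import Relation.Nullary using (¬_; yes; no; Dec)
open import Relation.Nullary.Decidable using (T?; dec-true; dec-false; ¬?; _×-dec_; _⊎-dec_; _→-dec_)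

private variable
  A B : Set
  n : ℕ

-- Filtering lists

length-filterᵇ-++ : (p : A → Bool) (xs ys : List A) →
  length (filterᵇ p (xs ++ ys)) ≡ length (filterᵇ p xs) + length (filterᵇ p ys)
length-filterᵇ-++ p xs ys = trans (cong length (filter-++ (T? ∘ p) xs ys)) (length-++ (filterᵇ p xs))

length-filterᵇ-map : (p : B → Bool) (f : A → B) (xs : List A) →
  length (filterᵇ p (map f xs)) ≡ length (filterᵇ (p ∘ f) xs)
length-filterᵇ-map p f [] = refl
length-filterᵇ-map p f (x ∷ xs) with p (f x)
... | true  = cong suc (length-filterᵇ-map p f xs)
... | false = length-filterᵇ-map p f xs

length-filterᵇ-false : (xs : List A) → length (filterᵇ (λ _ → false) xs) ≡ 0
length-filterᵇ-false []       = refl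
length-filterᵇ-false (x ∷ xs) = length-filterᵇ-false xs

length-filterᵇ-≤ : (p : A → Bool) (xs : List A) → length (filterᵇ p xs) ≤ length xs
length-filterᵇ-≤ p = length-filter (T? ∘ p)

length-filterᵇ-partition : (p : A → Bool) (xs : List A) →
  length (filterᵇ p xs) + length (filterᵇ (not ∘ p) xs) ≡ length xs
length-filterᵇ-partition p [] = refl
length-filterᵇ-partition p (x ∷ xs) with p x
... | true  = cong suc (length-filterᵇ-partition p xs)
... | false = trans (+-suc _ _) (cong suc (length-filterᵇ-partition p xs))

filterᵇ-cong : {p q : A → Bool} → (∀ x → p x ≡ q x) → (xs : List A) → filterᵇ p xs ≡ filterᵇ q xs
filterᵇ-cong e [] = refl
filterᵇ-cong {q = q} e (x ∷ xs) rewrite e x with q x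
... | true  = cong (x ∷_) (filterᵇ-cong e xs)
... | false = filterᵇ-cong e xs

filterᵇ-filterᵇ : (p q : A → Bool) (xs : List A) →
  filterᵇ p (filterᵇ q xs) ≡ filterᵇ (λ x → q x ∧ p x) xs
filterᵇ-filterᵇ p q [] = refl
filterᵇ-filterᵇ p q (x ∷ xs) with q x
... | false = filterᵇ-filterᵇ p q xs
... | true with p x
...   | true  = cong (x ∷_) (filterᵇ-filterᵇ p q xs)
...   | false = filterᵇ-filterᵇ p q xs

filterᵇ-comm : (p q : A → Bool) (xs : List A) → filterᵇ p (filterᵇ q xs) ≡ filterᵇ q (filterᵇ p xs)
filterᵇ-comm p q xs = trans (filterᵇ-filterᵇ p q xs)
  (trans (filterᵇ-cong (λ x → ∧-comm (q x) (p x)) xs) (sym (filterᵇ-filterᵇ q p xs)))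

filterᵇ⁺ : {p q : A → Bool} → (∀ x → T (p x) → T (q x)) → {xs ys : List A} →
  xs ⊆ ys → filterᵇ p xs ⊆ filterᵇ q ys
filterᵇ⁺ {p = p} {q} p⇒q = filter⁺ (T? ∘ p) (T? ∘ q) λ { refl → p⇒q _ }

filterᵇ-⊆ : (p : A → Bool) (xs : List A) → filterᵇ p xs ⊆ xs
filterᵇ-⊆ p = filter-⊆ (T? ∘ p)

filterᵇ-accept : (p : A → Bool) {x : A} (xs : List A) → p x ≡ true → filterᵇ p (x ∷ xs) ≡ x ∷ filterᵇ p xs
filterᵇ-accept p xs px rewrite px = refl

filterᵇ-reject : (p : A → Bool) {x : A} (xs : List A) → p x ≡ false → filterᵇ p (x ∷ xs) ≡ filterᵇ p xs
filterᵇ-reject p xs px rewrite px = refl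

module _ (_==_ : A → A → Bool) (==⇒≡ : ∀ {x y} → x == y ≡ true → x ≡ y) where

  filterᵇ-agree : (p q : A → Bool) (f : A) (xs : List A) → length (filterᵇ (_== f) xs) ≡ 0 →
    (∀ x → x == f ≡ false → p x ≡ q x) → filterᵇ p xs ≡ filterᵇ q xs
  filterᵇ-agree p q f []       none agree = refl
  filterᵇ-agree p q f (x ∷ xs) none agree with x == f in x=f
  ... | false rewrite agree x x=f with q x
  ...   | true  = cong (x ∷_) (filterᵇ-agree p q f xs none agree)
  ...   | false = filterᵇ-agree p q f xs none agree

  filterᵇ-around : (p q : A → Bool) (f : A) (xs : List A) → length (filterᵇ (_== f) xs) ≡ 1 →
    (∀ x → x == f ≡ false → p x ≡ q x) → p f ≡ false → q f ≡ true →
    Σ[ as ∈ List A ] Σ[ bs ∈ List A ] (filterᵇ p xs ≡ as ++ bs × filterᵇ q xs ≡ as ++ f ∷ bs)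
  filterᵇ-around p q f (x ∷ xs) once agree pf qf with x == f in x=f
  ... | true with refl ← ==⇒≡ x=f =
    [] , filterᵇ p xs , filterᵇ-reject p xs pf ,
    trans (filterᵇ-accept q xs qf)
          (cong (x ∷_) (filterᵇ-agree q p f xs (suc-injective once) (λ y y≠f → sym (agree y y≠f))))
  ... | false with filterᵇ-around p q f xs once agree pf qf | p x in px
  ...   | as , bs , p-xs , q-xs | true  = x ∷ as , bs ,
    cong (x ∷_) p-xs ,
    trans (filterᵇ-accept q xs (trans (sym (agree x x=f)) px)) (cong (x ∷_) q-xs)
  ...   | as , bs , p-xs , q-xs | false = as , bs ,
    p-xs ,
    trans (filterᵇ-reject q xs (trans (sym (agree x x=f)) px)) q-xs

∃-accepted-rejected : (q p : A → Bool) (xs : List A) →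
  length (filterᵇ p (filterᵇ q xs)) < length (filterᵇ q xs) → ∃[ x ] (q x ≡ true × p x ≡ false)
∃-accepted-rejected q p (x ∷ xs) fewer with q x in qx
... | false = ∃-accepted-rejected q p xs fewer
... | true with p x in px
...   | false = x , qx , px
...   | true  = ∃-accepted-rejected q p xs (≤-pred fewer)

unique-lookup-injective : {xs : List A} → Unique xs → ∀ i j → lookup xs i ≡ lookup xs j → i ≡ j
unique-lookup-injective (_ ∷ _)   zero    zero    _  = refl
unique-lookup-injective (x∉ ∷ _)  zero    (suc j) eq = ⊥-elim (All.lookup x∉ (∈-lookup j) eq)
unique-lookup-injective (x∉ ∷ _)  (suc i) zero    eq = ⊥-elim (All.lookup x∉ (∈-lookup i) (sym eq))
unique-lookup-injective (_ ∷ uxs) (suc i) (suc j) eq = cong suc (unique-lookup-injective uxs i j eq)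

length-filterᵇ-choose : (k : ℕ) (p : A → Bool) (q : List A → Bool) (xs : List A) →
  length (filterᵇ (λ S → allᵇ p S ∧ q S) (choose k xs)) ≡ length (filterᵇ q (choose k (filterᵇ p xs)))
length-filterᵇ-choose zero    p q xs with q []
... | true  = refl
... | false = refl
length-filterᵇ-choose (suc k) p q []       = refl
length-filterᵇ-choose (suc k) p q (x ∷ xs) = begin
    length (filterᵇ r (map (x ∷_) (choose k xs) ++ choose (suc k) xs))
  ≡⟨ length-filterᵇ-++ r (map (x ∷_) (choose k xs)) _ ⟩
    length (filterᵇ r (map (x ∷_) (choose k xs))) + length (filterᵇ r (choose (suc k) xs))
  ≡⟨ cong₂ _+_ (length-filterᵇ-map r (x ∷_) (choose k xs)) (length-filterᵇ-choose (suc k) p q xs) ⟩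
    length (filterᵇ (λ S → (p x ∧ allᵇ p S) ∧ q (x ∷ S)) (choose k xs))
      + length (filterᵇ q (choose (suc k) (filterᵇ p xs)))
  ≡⟨ split-at-x ⟩
    length (filterᵇ q (choose (suc k) (filterᵇ p (x ∷ xs)))) ∎
  where
  open ≡-Reasoning
  r : List _ → Bool
  r S = allᵇ p S ∧ q S
  split-at-x : length (filterᵇ (λ S → (p x ∧ allᵇ p S) ∧ q (x ∷ S)) (choose k xs))
           + length (filterᵇ q (choose (suc k) (filterᵇ p xs)))
         ≡ length (filterᵇ q (choose (suc k) (filterᵇ p (x ∷ xs))))
  split-at-x with p x
  ... | true  = trans (cong (_+ _) (trans (length-filterᵇ-choose k p (q ∘ (x ∷_)) xs)
                                          (sym (length-filterᵇ-map q (x ∷_) (choose k (filterᵇ p xs))))))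
                      (sym (length-filterᵇ-++ q (map (x ∷_) (choose k (filterᵇ p xs))) _))
  ... | false = cong (_+ length (filterᵇ q (choose (suc k) (filterᵇ p xs))))
                     (length-filterᵇ-false (choose k xs))

-- Vertices and edges

eqᵇ-refl : (a : Fin n) → eqᵇ a a ≡ true
eqᵇ-refl a = dec-true (a ≟ a) refl

eqᵇ-sym : (a b : Fin n) → eqᵇ a b ≡ eqᵇ b a
eqᵇ-sym a b with a ≟ b
... | yes refl = sym (eqᵇ-refl a)
... | no a≢b   = sym (dec-false (b ≟ a) (a≢b ∘ sym))

eqᵇ-true⇒≡ : {a b : Fin n} → eqᵇ a b ≡ true → a ≡ b
eqᵇ-true⇒≡ {a = a} {b} e with a ≟ b
... | yes a≡b = a≡b
eqᵇ-true⇒≡ () | no _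

≢⇒eqᵇ-false : {a b : Fin n} → ¬ a ≡ b → eqᵇ a b ≡ false
≢⇒eqᵇ-false {a = a} {b} = dec-false (a ≟ b)

eqᵇ-false⇒≢ : {a b : Fin n} → eqᵇ a b ≡ false → ¬ a ≡ b
eqᵇ-false⇒≢ {a = a} e refl with () ← trans (sym (eqᵇ-refl a)) e

T⇒≡true : ∀ {b} → T b → b ≡ true
T⇒≡true = Equivalence.to T-≡

¬T⇒≡false : ∀ {b} → ¬ T b → b ≡ false
¬T⇒≡false {true}  ¬b = ⊥-elim (¬b _)
¬T⇒≡false {false} _  = refl

Edge : ℕ → Set
Edge n = Fin n × Fin n

∧-swap-middle : ∀ w x y z → w ∧ x ∧ y ∧ z ≡ w ∧ y ∧ x ∧ z
∧-swap-middle w true  true  z = refl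
∧-swap-middle w true  false z = refl
∧-swap-middle w false true  z = refl
∧-swap-middle w false false z = refl

∧-swap-halves : ∀ w x y z → w ∧ x ∧ y ∧ z ≡ y ∧ z ∧ w ∧ x
∧-swap-halves w x y z = trans (sym (∧-assoc w x (y ∧ z)))
  (trans (∧-comm (w ∧ x) (y ∧ z)) (∧-assoc y z (w ∧ x)))

disjointEdges-sym : (e f : Edge n) → disjointEdges e f ≡ disjointEdges f e
disjointEdges-sym (a , b) (c , d)
  rewrite eqᵇ-sym c a | eqᵇ-sym c b | eqᵇ-sym d a | eqᵇ-sym d b =
  ∧-swap-middle (not (eqᵇ a c)) (not (eqᵇ a d)) (not (eqᵇ b c)) (not (eqᵇ b d))

disjointEdges-irrefl : (e : Edge n) → disjointEdges e e ≡ false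
disjointEdges-irrefl (a , b) rewrite eqᵇ-refl a = refl

disjointEdges-flip : (u v : Fin n) (e : Edge n) → disjointEdges (v , u) e ≡ disjointEdges (u , v) e
disjointEdges-flip u v (i , j) =
  ∧-swap-halves (not (eqᵇ v i)) (not (eqᵇ v j)) (not (eqᵇ u i)) (not (eqᵇ u j))

disjoint-endpoints : (a b i j : Fin n) → disjointEdges (a , b) (i , j) ≡ true →
  eqᵇ a i ≡ false × eqᵇ a j ≡ false × eqᵇ b i ≡ false × eqᵇ b j ≡ false
disjoint-endpoints a b i j h with eqᵇ a i | eqᵇ a j | eqᵇ b i | eqᵇ b j
... | false | false | false | false = refl , refl , refl , refl
disjoint-endpoints a b i j () | true  | _     | _     | _
disjoint-endpoints a b i j () | false | true  | _     | _
disjoint-endpoints a b i j () | false | false | true  | _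
disjoint-endpoints a b i j () | false | false | false | true

avoiding : Edge n → List (Edge n) → List (Edge n)
avoiding e = filterᵇ (disjointEdges e)

avoiding-⊆ : (e : Edge n) (es : List (Edge n)) → avoiding e es ⊆ es
avoiding-⊆ e = filterᵇ-⊆ (disjointEdges e)

avoiding⁺ : (e : Edge n) {es fs : List (Edge n)} → es ⊆ fs → avoiding e es ⊆ avoiding e fs
avoiding⁺ e = filterᵇ⁺ (λ _ → id)

avoiding-avoiding-⊆ : (a b c : Fin n) (es : List (Edge n)) →
  avoiding (a , a) (avoiding (b , c) es) ⊆ avoiding (a , b) es
avoiding-avoiding-⊆ {n} a b c es = subst (_⊆ avoiding (a , b) es)
  (sym (filterᵇ-filterᵇ (disjointEdges (a , a)) (disjointEdges (b , c)) es))
  (filterᵇ⁺ misses-a-and-b (⊆-refl {x = es}))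
  where
  misses-bc misses-a : Fin n → Fin n → Bool
  misses-bc i j = disjointEdges (b , c) (i , j)
  misses-a  i j = disjointEdges (a , a) (i , j)
  misses-a-and-b : ∀ e → T (disjointEdges (b , c) e ∧ disjointEdges (a , a) e) → T (disjointEdges (a , b) e)
  misses-a-and-b (i , j) both
    with b≢i , b≢j , _ ← disjoint-endpoints b c i j (∧-conicalˡ (misses-bc i j) _ (T⇒≡true both))
       | a≢i , a≢j , _ ← disjoint-endpoints a a i j (∧-conicalʳ (misses-bc i j) (misses-a i j) (T⇒≡true both))
    rewrite a≢i | a≢j | b≢i | b≢j = _

-- Counting matchings

matchings : ℕ → List (Edge n) → ℕ
matchings zero    es       = 1
matchings (suc k) []       = 0
matchings (suc k) (e ∷ es) = matchings k (avoiding e es) + matchings (suc k) es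

length-pairwiseDisjoint-choose : (k : ℕ) (es : List (Edge n)) →
  length (filterᵇ pairwiseDisjoint (choose k es)) ≡ matchings k es
length-pairwiseDisjoint-choose zero    es       = refl
length-pairwiseDisjoint-choose (suc k) []       = refl
length-pairwiseDisjoint-choose (suc k) (e ∷ es) =
  trans (length-filterᵇ-++ pairwiseDisjoint (map (e ∷_) (choose k es)) _)
        (cong₂ _+_ (trans (length-filterᵇ-map pairwiseDisjoint (e ∷_) (choose k es))
                   (trans (length-filterᵇ-choose k (disjointEdges e) pairwiseDisjoint es)
                          (length-pairwiseDisjoint-choose k (avoiding e es))))
                   (length-pairwiseDisjoint-choose (suc k) es))

countM≡matchings : (k : ℕ) (G : Graph n) → countM k G ≡ matchings k (edges G)
countM≡matchings k G = length-pairwiseDisjoint-choose k (edges G)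

matchings-∷ʳ : (k : ℕ) (e : Edge n) (es : List (Edge n)) → matchings k es ≤ matchings k (e ∷ es)
matchings-∷ʳ zero    e es = ≤-refl
matchings-∷ʳ (suc k) e es = m≤n+m _ _

matchings-mono : (k : ℕ) {es fs : List (Edge n)} → es ⊆ fs → matchings k es ≤ matchings k fs
matchings-mono zero    _          = ≤-refl
matchings-mono (suc k) []         = ≤-refl
matchings-mono (suc k) (_∷ʳ_ {ys = fs} f τ) =
  ≤-trans (matchings-mono (suc k) τ) (matchings-∷ʳ (suc k) f fs)
matchings-mono (suc k) (_∷_ {x = e} refl τ) =
  +-mono-≤ (matchings-mono k (avoiding⁺ e τ)) (matchings-mono (suc k) τ)

m^k+m^[1+k]≤[1+m]^[1+k] : ∀ m k → m ^ k + m ^ suc k ≤ suc m ^ suc k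
m^k+m^[1+k]≤[1+m]^[1+k] m k = *-monoʳ-≤ (suc m) (^-monoˡ-≤ k (n≤1+n m))

matchings≤length^ : (k : ℕ) (es : List (Edge n)) → matchings k es ≤ length es ^ k
matchings≤length^ zero    es       = ≤-refl
matchings≤length^ (suc k) []       = z≤n
matchings≤length^ (suc k) (e ∷ es) = ≤-trans
  (+-mono-≤ (≤-trans (matchings≤length^ k (avoiding e es))
                     (^-monoˡ-≤ k (length-filterᵇ-≤ (disjointEdges e) es)))
            (matchings≤length^ (suc k) es))
  (m^k+m^[1+k]≤[1+m]^[1+k] (length es) k)

+-interchange : ∀ a b c d → (a + b) + (c + d) ≡ (a + c) + (b + d)
+-interchange = interchange +-commutativeSemigroup

matchings-insert : (k : ℕ) (as bs : List (Edge n)) (f : Edge n) →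
  matchings (suc k) (as ++ f ∷ bs) ≡ matchings (suc k) (as ++ bs) + matchings k (avoiding f (as ++ bs))
matchings-insert k [] bs f = +-comm (matchings k (avoiding f bs)) (matchings (suc k) bs)
matchings-insert k (a ∷ as) bs f with disjointEdges f a in f#a
... | false = begin
    matchings k (avoiding a (as ++ f ∷ bs)) + matchings (suc k) (as ++ f ∷ bs)
  ≡⟨ cong₂ _+_ (cong (matchings k) drop-f) (matchings-insert k as bs f) ⟩
    matchings k (avoiding a (as ++ bs)) + (matchings (suc k) (as ++ bs) + matchings k (avoiding f (as ++ bs)))
  ≡⟨ +-assoc (matchings k (avoiding a (as ++ bs))) (matchings (suc k) (as ++ bs)) _ ⟨
    matchings (suc k) (a ∷ as ++ bs) + matchings k (avoiding f (as ++ bs)) ∎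
  where
  open ≡-Reasoning
  drop-f : avoiding a (as ++ f ∷ bs) ≡ avoiding a (as ++ bs)
  drop-f = begin
    avoiding a (as ++ f ∷ bs)            ≡⟨ filter-++ (T? ∘ disjointEdges a) as (f ∷ bs) ⟩
    avoiding a as ++ avoiding a (f ∷ bs) ≡⟨ cong (avoiding a as ++_)
      (filterᵇ-reject (disjointEdges a) bs (trans (disjointEdges-sym a f) f#a)) ⟩
    avoiding a as ++ avoiding a bs       ≡⟨ filter-++ (T? ∘ disjointEdges a) as bs ⟨
    avoiding a (as ++ bs)                ∎
matchings-insert zero (a ∷ as) bs f | true = cong suc (matchings-insert zero as bs f)
matchings-insert (suc k) (a ∷ as) bs f | true = begin
    matchings (suc k) (avoiding a (as ++ f ∷ bs)) + matchings (suc (suc k)) (as ++ f ∷ bs)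
  ≡⟨ cong₂ _+_ (trans (cong (matchings (suc k)) keep-f)
                      (matchings-insert k (avoiding a as) (avoiding a bs) f))
               (matchings-insert (suc k) as bs f) ⟩
    (matchings (suc k) (avoiding a as ++ avoiding a bs)
      + matchings k (avoiding f (avoiding a as ++ avoiding a bs)))
      + (matchings (suc (suc k)) (as ++ bs) + matchings (suc k) W)
  ≡⟨ cong₂ (λ L M → (matchings (suc k) L + matchings k M) + (matchings (suc (suc k)) (as ++ bs) + matchings (suc k) W))
           (sym split-a)
           (trans (cong (avoiding f) (sym split-a)) (filterᵇ-comm (disjointEdges f) (disjointEdges a) (as ++ bs))) ⟩
    (matchings (suc k) (avoiding a (as ++ bs)) + matchings k (avoiding a W))
      + (matchings (suc (suc k)) (as ++ bs) + matchings (suc k) W)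
  ≡⟨ +-interchange (matchings (suc k) (avoiding a (as ++ bs))) (matchings k (avoiding a W))
                   (matchings (suc (suc k)) (as ++ bs)) (matchings (suc k) W) ⟩
    matchings (suc (suc k)) (a ∷ as ++ bs) + matchings (suc k) (a ∷ W) ∎
  where
  open ≡-Reasoning
  W = avoiding f (as ++ bs)
  split-a : avoiding a (as ++ bs) ≡ avoiding a as ++ avoiding a bs
  split-a = filter-++ (T? ∘ disjointEdges a) as bs
  keep-f : avoiding a (as ++ f ∷ bs) ≡ avoiding a as ++ f ∷ avoiding a bs
  keep-f = trans (filter-++ (T? ∘ disjointEdges a) as (f ∷ bs))
    (cong (avoiding a as ++_) (filterᵇ-accept (disjointEdges a) bs (trans (disjointEdges-sym a f) f#a)))

matchings-filterᵇ : (k : ℕ) (p : Edge n → Bool) (es : List (Edge n)) →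
  matchings (suc k) es ≤ matchings (suc k) (filterᵇ p es) + length (filterᵇ (not ∘ p) es) * length es ^ k
matchings-filterᵇ k p [] = z≤n
matchings-filterᵇ k p (e ∷ es) with p e
matchings-filterᵇ zero p (e ∷ es) | true = s≤s (matchings-filterᵇ zero p es)
matchings-filterᵇ (suc k) p (e ∷ es) | true = begin
    matchings (suc k) (avoiding e es) + matchings (suc (suc k)) es
  ≤⟨ +-mono-≤ first (matchings-filterᵇ (suc k) p es) ⟩
    (matchings (suc k) (avoiding e (filterᵇ p es)) + r * l ^ k)
      + (matchings (suc (suc k)) (filterᵇ p es) + r * l ^ suc k)
  ≡⟨ +-interchange (matchings (suc k) (avoiding e (filterᵇ p es))) (r * l ^ k)
                   (matchings (suc (suc k)) (filterᵇ p es)) (r * l ^ suc k) ⟩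
    matchings (suc (suc k)) (e ∷ filterᵇ p es) + (r * l ^ k + r * l ^ suc k)
  ≤⟨ +-monoʳ-≤ (matchings (suc (suc k)) (e ∷ filterᵇ p es)) (≤-trans (≤-reflexive (sym (*-distribˡ-+ r (l ^ k) _)))
                          (*-monoʳ-≤ r (m^k+m^[1+k]≤[1+m]^[1+k] l k))) ⟩
    matchings (suc (suc k)) (e ∷ filterᵇ p es) + r * suc l ^ suc k ∎
  where
  open ≤-Reasoning
  r = length (filterᵇ (not ∘ p) es)
  l = length es
  first : matchings (suc k) (avoiding e es) ≤ matchings (suc k) (avoiding e (filterᵇ p es)) + r * l ^ k
  first = ≤-trans (matchings-filterᵇ k p (avoiding e es))
    (+-mono-≤ (≤-reflexive (cong (matchings (suc k)) (filterᵇ-comm p (disjointEdges e) es)))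
              (*-mono-≤ (≤-trans (≤-reflexive (cong length (filterᵇ-comm (not ∘ p) (disjointEdges e) es)))
                                 (length-filterᵇ-≤ (disjointEdges e) (filterᵇ (not ∘ p) es)))
                        (^-monoˡ-≤ k (length-filterᵇ-≤ (disjointEdges e) es))))
matchings-filterᵇ k p (e ∷ es) | false = begin
    matchings k (avoiding e es) + matchings (suc k) es
  ≤⟨ +-mono-≤ (≤-trans (matchings≤length^ k (avoiding e es))
                       (^-monoˡ-≤ k (≤-trans (length-filterᵇ-≤ (disjointEdges e) es) (n≤1+n l))))
              (matchings-filterᵇ k p es) ⟩
    suc l ^ k + (matchings (suc k) (filterᵇ p es) + r * l ^ k)
  ≤⟨ +-monoʳ-≤ (suc l ^ k) (+-monoʳ-≤ M (*-monoʳ-≤ r (^-monoˡ-≤ k (n≤1+n l)))) ⟩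
    suc l ^ k + (M + r * suc l ^ k)
  ≡⟨ +-comm (suc l ^ k) (M + r * suc l ^ k) ⟩
    (M + r * suc l ^ k) + suc l ^ k
  ≡⟨ +-assoc M (r * suc l ^ k) (suc l ^ k) ⟩
    M + (r * suc l ^ k + suc l ^ k)
  ≡⟨ cong (M +_) (+-comm (r * suc l ^ k) (suc l ^ k)) ⟩
    M + suc r * suc l ^ k ∎
  where
  open ≤-Reasoning
  r = length (filterᵇ (not ∘ p) es)
  l = length es
  M = matchings (suc k) (filterᵇ p es)

MeetsAtMost : ℕ → List (Edge n) → Set
MeetsAtMost {n} β es = ∀ (f : Edge n) → length (filterᵇ (not ∘ disjointEdges f) es) ≤ β

MeetsAtMost-⊆ : {β : ℕ} {es fs : List (Edge n)} → es ⊆ fs → MeetsAtMost β fs → MeetsAtMost β es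
MeetsAtMost-⊆ τ meets f = ≤-trans (length-mono-≤ (filterᵇ⁺ (λ _ → id) τ)) (meets f)

length≤length-avoiding+ : {β : ℕ} {es : List (Edge n)} → MeetsAtMost β es → (f : Edge n) →
  length es ≤ length (avoiding f es) + β
length≤length-avoiding+ {β = β} {es} meets f = begin
  length es                                                            ≡⟨ length-filterᵇ-partition (disjointEdges f) es ⟨
  length (avoiding f es) + length (filterᵇ (not ∘ disjointEdges f) es) ≤⟨ +-monoʳ-≤ _ (meets f) ⟩
  length (avoiding f es) + β                                           ∎
  where open ≤-Reasoning

room-after : {β X : ℕ} (e : Edge n) (es : List (Edge n)) → MeetsAtMost (suc β) (e ∷ es) →
  suc β + X ≤ suc (length es) → X ≤ length es × X ≤ length (avoiding e es)
room-after {β = β} {X} e es meets large =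
    ≤-trans (m≤n+m X β) (≤-pred large)
  , +-cancelˡ-≤ β X _ (≤-trans (≤-pred large) (≤-trans length≤ (≤-reflexive (+-comm _ β))))
  where
  length≤ : length es ≤ length (avoiding e es) + β
  length≤ = ≤-pred (≤-trans (length≤length-avoiding+ meets e)
    (≤-reflexive (trans (cong (λ es′ → length es′ + suc β) (filterᵇ-reject (disjointEdges e) es (disjointEdges-irrefl e)))
                        (+-suc _ β))))

matchings-lower : (k b β c : ℕ) (es : List (Edge n)) → MeetsAtMost (suc β) es →
  (c + k * b) * suc β ≤ length es → c * b ^ k ≤ matchings (suc k) es
matchings-lower k       b β zero    es       meets large = z≤n
matchings-lower zero    b β (suc c) (e ∷ es) meets large =
  s≤s (matchings-lower zero b β c es (MeetsAtMost-⊆ (e ∷ʳ ⊆-refl) meets) (proj₁ (room-after e es meets large)))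
matchings-lower (suc k) b β (suc c) (e ∷ es) meets large =
  +-mono-≤ (matchings-lower k b β b (avoiding e es) (MeetsAtMost-⊆ (e ∷ʳ avoiding-⊆ e es) meets)
              (≤-trans (*-monoˡ-≤ (suc β) (m≤n+m (suc k * b) c)) (proj₂ room)))
           (matchings-lower (suc k) b β c es (MeetsAtMost-⊆ (e ∷ʳ ⊆-refl) meets) (proj₁ room))
  where
  room = room-after e es meets large

-- Degrees and numbers of edges

𝟙 : Bool → ℕ
𝟙 true  = 1
𝟙 false = 0

𝟙-∧ : ∀ a b → 𝟙 (a ∧ b) ≡ 𝟙 a * 𝟙 b
𝟙-∧ true  b = sym (+-identityʳ (𝟙 b))
𝟙-∧ false b = refl

𝟙-∨-≤ : ∀ a b → 𝟙 (a ∨ b) ≤ 𝟙 a + 𝟙 b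
𝟙-∨-≤ true  b = s≤s z≤n
𝟙-∨-≤ false b = ≤-refl

𝟙-∨-exclusive : ∀ a b → (a ≡ true → b ≡ true → ⊥) → 𝟙 (a ∨ b) ≡ 𝟙 a + 𝟙 b
𝟙-∨-exclusive true  true  excl = ⊥-elim (excl refl refl)
𝟙-∨-exclusive true  false excl = refl
𝟙-∨-exclusive false b     excl = refl

∑-mono-≤ : {f g : Fin n → ℕ} → (∀ i → f i ≤ g i) → sum f ≤ sum g
∑-mono-≤ {zero}  f≤g = z≤n
∑-mono-≤ {suc n} f≤g = +-mono-≤ (f≤g zero) (∑-mono-≤ (f≤g ∘ suc))

∑-const : ∀ n c → ∑[ i < n ] c ≡ n * c
∑-const zero    c = refl
∑-const (suc n) c = cong (c +_) (∑-const n c)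

∑-𝟙-≡ : (a : Fin n) → ∑[ i < n ] 𝟙 (eqᵇ i a) ≡ 1
∑-𝟙-≡ {suc n} zero    = cong suc (trans (∑-const n 0) (*-zeroʳ n))
∑-𝟙-≡ {suc n} (suc a) = ∑-𝟙-≡ a

∑-𝟙-∨-≤ : (A B : Fin n → Bool) → ∑[ i < n ] 𝟙 (A i ∨ B i) ≤ ∑[ i < n ] 𝟙 (A i) + ∑[ i < n ] 𝟙 (B i)
∑-𝟙-∨-≤ A B =
  ≤-trans (∑-mono-≤ (λ i → 𝟙-∨-≤ (A i) (B i))) (≤-reflexive (∑-distrib-+ (𝟙 ∘ A) (𝟙 ∘ B)))

length-filterᵇ-tabulate : (p : A → Bool) (g : Fin n → A) →
  length (filterᵇ p (tabulate g)) ≡ ∑[ j < n ] 𝟙 (p (g j))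
length-filterᵇ-tabulate {n = zero}  p g = refl
length-filterᵇ-tabulate {n = suc n} p g with p (g zero)
... | true  = cong suc (length-filterᵇ-tabulate p (g ∘ suc))
... | false = length-filterᵇ-tabulate p (g ∘ suc)

deg≡∑ : (G : Graph n) (v : Fin n) → deg G v ≡ ∑[ j < n ] 𝟙 (adj G v j)
deg≡∑ G v = length-filterᵇ-tabulate (adj G v) id

allPairs : ∀ n → List (Edge n)
allPairs n = concatMap (λ i → map (i ,_) (allFin n)) (allFin n)

length-filterᵇ-allPairs : (q : Edge n → Bool) →
  length (filterᵇ q (allPairs n)) ≡ ∑[ i < n ] ∑[ j < n ] 𝟙 (q (i , j))
length-filterᵇ-allPairs {n} q = trans (rows id) (sum-cong-≗ λ i →
  trans (length-filterᵇ-map q (i ,_) (allFin n)) (length-filterᵇ-tabulate (λ j → q (i , j)) id))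
  where
  rows : ∀ {m} (g : Fin m → Fin n) → length (filterᵇ q (concatMap (λ i → map (i ,_) (allFin n)) (tabulate g)))
       ≡ ∑[ i < m ] length (filterᵇ q (map (g i ,_) (allFin n)))
  rows {zero}  g = refl
  rows {suc m} g = trans (length-filterᵇ-++ q (map (g zero ,_) (allFin n)) _)
    (cong (length (filterᵇ q (map (g zero ,_) (allFin n))) +_) (rows (g ∘ suc)))

_<ᶠ_ : Fin n → Fin n → Bool
i <ᶠ j = toℕ i <ᵇ toℕ j

data Compare (i j : Fin n) : Set where
  less    : i <ᶠ j ≡ true  → j <ᶠ i ≡ false → Compare i j
  greater : i <ᶠ j ≡ false → j <ᶠ i ≡ true  → Compare i j
  equal   : i ≡ j → Compare i j

compare : (i j : Fin n) → Compare i j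
compare i j with <-cmp (toℕ i) (toℕ j)
... | tri< i<j _ j≮i = less    (T⇒≡true (<⇒<ᵇ i<j)) (¬T⇒≡false (j≮i ∘ <ᵇ⇒< (toℕ j) (toℕ i)))
... | tri≈ _ i≡j _   = equal   (toℕ-injective i≡j)
... | tri> i≮j _ j<i = greater (¬T⇒≡false (i≮j ∘ <ᵇ⇒< (toℕ i) (toℕ j))) (T⇒≡true (<⇒<ᵇ j<i))

<ᶠ-irrefl : (i : Fin n) → i <ᶠ i ≡ false
<ᶠ-irrefl i = ¬T⇒≡false (n≮n (toℕ i) ∘ <ᵇ⇒< (toℕ i) (toℕ i))

isEdge : Graph n → Edge n → Bool
isEdge G (i , j) = (i <ᶠ j) ∧ adj G i j

#edges : Graph n → ℕ
#edges G = length (edges G)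

#edges≡∑ : (G : Graph n) → #edges G ≡ ∑[ i < n ] ∑[ j < n ] 𝟙 (isEdge G (i , j))
#edges≡∑ G = length-filterᵇ-allPairs (isEdge G)

#edges≤#allPairs : (G : Graph n) → #edges G ≤ length (allPairs n)
#edges≤#allPairs {n} G = length-filterᵇ-≤ (isEdge G) (allPairs n)

𝟙-adj-split : (G : Graph n) (i j : Fin n) → 𝟙 (adj G i j) ≡ 𝟙 (isEdge G (i , j)) + 𝟙 (isEdge G (j , i))
𝟙-adj-split G i j with compare i j
... | less    i<j j≮i rewrite i<j | j≮i = sym (+-identityʳ _)
... | greater i≮j j<i rewrite i≮j | j<i = cong 𝟙 (Graph.sym G i j)
... | equal refl rewrite <ᶠ-irrefl i | irref G i = refl

handshake : (G : Graph n) → ∑[ v < n ] deg G v ≡ #edges G + #edges G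
handshake {n} G = begin
  ∑[ i < n ] deg G i                                           ≡⟨ sum-cong-≗ (deg≡∑ G) ⟩
  ∑[ i < n ] ∑[ j < n ] 𝟙 (adj G i j)                          ≡⟨ sum-cong-≗ (λ i → sum-cong-≗ (𝟙-adj-split G i)) ⟩
  ∑[ i < n ] ∑[ j < n ] (out i j + into i j)                   ≡⟨ sum-cong-≗ (λ i → ∑-distrib-+ (out i) (into i)) ⟩
  ∑[ i < n ] (∑[ j < n ] out i j + ∑[ j < n ] into i j)        ≡⟨ ∑-distrib-+ (λ i → sum (out i)) (λ i → sum (into i)) ⟩
  ∑[ i < n ] ∑[ j < n ] out i j + ∑[ i < n ] ∑[ j < n ] into i j ≡⟨ cong (sum (λ i → sum (out i)) +_) (∑-comm into) ⟩
  ∑[ i < n ] ∑[ j < n ] out i j + ∑[ j < n ] ∑[ i < n ] out j i ≡⟨ cong₂ _+_ (#edges≡∑ G) (#edges≡∑ G) ⟨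
  #edges G + #edges G                                          ∎
  where
  open ≡-Reasoning
  out into : Fin n → Fin n → ℕ
  out  i j = 𝟙 (isEdge G (i , j))
  into i j = 𝟙 (isEdge G (j , i))

MaxDeg : Graph n → ℕ → Set
MaxDeg {n} G D = ∀ (v : Fin n) → deg G v ≤ D

∑deg≤ : (G : Graph n) {D : ℕ} → MaxDeg G D → ∑[ v < n ] deg G v ≤ n * D
∑deg≤ {n} G {D} maxdeg = ≤-trans (∑-mono-≤ maxdeg) (≤-reflexive (∑-const n D))

#edges≤ : (G : Graph n) {D : ℕ} → MaxDeg G D → #edges G ≤ n * D
#edges≤ G maxdeg = ≤-trans (m≤m+n (#edges G) (#edges G))
  (≤-trans (≤-reflexive (sym (handshake G))) (∑deg≤ G maxdeg))

touching : (Fin n → Bool) → Edge n → Bool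
touching S (i , j) = S i ∨ S j

∑-𝟙*deg≤ : (G : Graph n) {D : ℕ} → MaxDeg G D → (S : Fin n → Bool) →
  ∑[ i < n ] (𝟙 (S i) * deg G i) ≤ D * ∑[ i < n ] 𝟙 (S i)
∑-𝟙*deg≤ G {D} maxdeg S = ≤-trans
  (∑-mono-≤ (λ i → ≤-trans (*-monoʳ-≤ (𝟙 (S i)) (maxdeg i)) (≤-reflexive (*-comm (𝟙 (S i)) D))))
  (≤-reflexive (sym (*-distribˡ-sum D (𝟙 ∘ S))))

#touching≤ : (G : Graph n) {D : ℕ} → MaxDeg G D → (S : Fin n → Bool) →
  length (filterᵇ (touching S) (edges G)) ≤ D * ∑[ i < n ] 𝟙 (S i) + D * ∑[ i < n ] 𝟙 (S i)
#touching≤ {n} G {D} maxdeg S = begin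
  length (filterᵇ (touching S) (filterᵇ (isEdge G) (allPairs n)))
    ≡⟨ cong length (filterᵇ-filterᵇ (touching S) (isEdge G) (allPairs n)) ⟩
  length (filterᵇ (λ e → isEdge G e ∧ touching S e) (allPairs n))
    ≡⟨ length-filterᵇ-allPairs (λ e → isEdge G e ∧ touching S e) ⟩
  ∑[ i < n ] ∑[ j < n ] 𝟙 (isEdge G (i , j) ∧ touching S (i , j))
    ≤⟨ ∑-mono-≤ (λ i → ∑-mono-≤ (λ j → pointwise i j)) ⟩
  ∑[ i < n ] ∑[ j < n ] (from i j + from j i)
    ≡⟨ trans (sum-cong-≗ (λ i → ∑-distrib-+ (from i) (λ j → from j i)))
             (∑-distrib-+ (λ i → sum (from i)) (λ i → sum (λ j → from j i))) ⟩
  ∑[ i < n ] ∑[ j < n ] from i j + ∑[ i < n ] ∑[ j < n ] from j i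
    ≡⟨ cong (sum (λ i → sum (from i)) +_) (∑-comm (λ i j → from j i)) ⟩
  ∑[ i < n ] ∑[ j < n ] from i j + ∑[ j < n ] ∑[ i < n ] from j i
    ≤⟨ +-mono-≤ from-S from-S ⟩
  D * ∑[ i < n ] 𝟙 (S i) + D * ∑[ i < n ] 𝟙 (S i) ∎
  where
  open ≤-Reasoning
  from : Fin n → Fin n → ℕ
  from i j = 𝟙 (S i) * 𝟙 (adj G i j)
  pointwise : ∀ i j → 𝟙 (isEdge G (i , j) ∧ touching S (i , j)) ≤ from i j + from j i
  pointwise i j rewrite Graph.sym G j i with i <ᶠ j | adj G i j | S i | S j
  ... | false | _     | _     | _     = z≤n
  ... | true  | false | _     | _     = z≤n
  ... | true  | true  | true  | _     = s≤s z≤n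
  ... | true  | true  | false | true  = s≤s z≤n
  ... | true  | true  | false | false = z≤n
  from-S : ∑[ i < n ] ∑[ j < n ] from i j ≤ D * ∑[ i < n ] 𝟙 (S i)
  from-S = ≤-trans (≤-reflexive (sum-cong-≗ λ i →
             trans (sym (*-distribˡ-sum (𝟙 (S i)) (λ j → 𝟙 (adj G i j)))) (cong (𝟙 (S i) *_) (sym (deg≡∑ G i)))))
           (∑-𝟙*deg≤ G maxdeg S)

meets⇒touches : (a b : Fin n) (e : Edge n) →
  T (not (disjointEdges (a , b) e)) → T (touching (λ z → eqᵇ z a ∨ eqᵇ z b) e)
meets⇒touches a b (i , j) meets rewrite eqᵇ-sym i a | eqᵇ-sym i b | eqᵇ-sym j a | eqᵇ-sym j b
  with eqᵇ a i | eqᵇ b i | eqᵇ a j | eqᵇ b j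
... | true  | _     | _     | _     = _
... | false | true  | _     | _     = _
... | false | false | true  | _     = _
... | false | false | false | true  = _

edges-MeetsAtMost : (G : Graph n) {D : ℕ} → MaxDeg G D → MeetsAtMost (D * 2 + D * 2) (edges G)
edges-MeetsAtMost {n} G {D} maxdeg (a , b) =
  ≤-trans (length-mono-≤ (filterᵇ⁺ (meets⇒touches a b) (⊆-refl {x = edges G})))
  (≤-trans (#touching≤ G maxdeg ends) (+-mono-≤ two-ends two-ends))
  where
  ends : Fin n → Bool
  ends z = eqᵇ z a ∨ eqᵇ z b
  two-ends : D * ∑[ z < n ] 𝟙 (ends z) ≤ D * 2
  two-ends = *-monoʳ-≤ D (≤-trans (∑-𝟙-∨-≤ (λ z → eqᵇ z a) (λ z → eqᵇ z b))
                                  (≤-reflexive (cong₂ _+_ (∑-𝟙-≡ a) (∑-𝟙-≡ b))))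

closedNbhd : Graph n → Fin n → Fin n → Bool
closedNbhd G u z = eqᵇ z u ∨ adj G u z

∑-closedNbhd≤ : (G : Graph n) {D : ℕ} → MaxDeg G D → (u : Fin n) → ∑[ z < n ] 𝟙 (closedNbhd G u z) ≤ suc D
∑-closedNbhd≤ G maxdeg u = ≤-trans (∑-𝟙-∨-≤ (λ z → eqᵇ z u) (adj G u))
  (≤-trans (≤-reflexive (cong₂ _+_ (∑-𝟙-≡ u) (sym (deg≡∑ G u)))) (s≤s (maxdeg u)))

farEdgeThreshold : ℕ → ℕ
farEdgeThreshold D = D * (suc D + suc D) + D * (suc D + suc D)

record FarEdge (G : Graph n) (u v : Fin n) : Set where
  field
    x y    : Fin n
    adj-xy : adj G x y ≡ true
    x≢y    : ¬ x ≡ y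
    x≢u    : ¬ x ≡ u
    x≢v    : ¬ x ≡ v
    y≢v    : ¬ y ≡ v
    ¬adj-ux : adj G u x ≡ false
    ¬adj-vy : adj G v y ≡ false

farEdge : (G : Graph n) {D : ℕ} → MaxDeg G D → (u v : Fin n) → farEdgeThreshold D < #edges G → FarEdge G u v
farEdge {n} G {D} maxdeg u v many = record
  { x = x ; y = y ; adj-xy = adj-xy ; x≢y = x≢y
  ; x≢u = eqᵇ-false⇒≢ (∨-conicalˡ (eqᵇ x u) (adj G u x) x∉N[u])
  ; x≢v = eqᵇ-false⇒≢ (∨-conicalˡ (eqᵇ x v) (adj G v x) x∉N[v])
  ; y≢v = eqᵇ-false⇒≢ (∨-conicalˡ (eqᵇ y v) (adj G v y) y∉N[v])
  ; ¬adj-ux = ∨-conicalʳ (eqᵇ x u) (adj G u x) x∉N[u]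
  ; ¬adj-vy = ∨-conicalʳ (eqᵇ y v) (adj G v y) y∉N[v] }
  where
  near : Fin n → Bool
  near z = closedNbhd G u z ∨ closedNbhd G v z
  near≤ : D * ∑[ z < n ] 𝟙 (near z) ≤ D * (suc D + suc D)
  near≤ = *-monoʳ-≤ D (≤-trans (∑-𝟙-∨-≤ (closedNbhd G u) (closedNbhd G v))
                               (+-mono-≤ (∑-closedNbhd≤ G maxdeg u) (∑-closedNbhd≤ G maxdeg v)))
  few-near : length (filterᵇ (touching near) (edges G)) < #edges G
  few-near = ≤-<-trans (≤-trans (#touching≤ G maxdeg near) (+-mono-≤ near≤ near≤)) many
  far = ∃-accepted-rejected (isEdge G) (touching near) (allPairs n) few-near
  x = proj₁ (proj₁ far)
  y = proj₂ (proj₁ far)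
  adj-xy : adj G x y ≡ true
  adj-xy = ∧-conicalʳ (x <ᶠ y) (adj G x y) (proj₁ (proj₂ far))
  x≢y : ¬ x ≡ y
  x≢y x≡y with () ← trans (sym adj-xy) (trans (cong (adj G x) (sym x≡y)) (irref G x))
  x∉near : near x ≡ false
  x∉near = ∨-conicalˡ (near x) (near y) (proj₂ (proj₂ far))
  y∉near : near y ≡ false
  y∉near = ∨-conicalʳ (near x) (near y) (proj₂ (proj₂ far))
  x∉N[u] : closedNbhd G u x ≡ false
  x∉N[u] = ∨-conicalˡ (closedNbhd G u x) (closedNbhd G v x) x∉near
  x∉N[v] : closedNbhd G v x ≡ false
  x∉N[v] = ∨-conicalʳ (closedNbhd G u x) (closedNbhd G v x) x∉near
  y∉N[v] : closedNbhd G v y ≡ false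
  y∉N[v] = ∨-conicalʳ (closedNbhd G u y) (closedNbhd G v y) y∉near

-- Stars

neighbours : Graph n → Fin n → List (Fin n)
neighbours {n} G v = filterᵇ (adj G v) (allFin n)

≤deg⇒containsStar : (G : Graph n) (v : Fin n) {r : ℕ} → r ≤ deg G v → ContainsStar r G
≤deg⇒containsStar G v r≤deg = v , leaf , leaf-injective , λ i → leaf-adjacent (inject≤ i r≤deg)
  where
  leaf : Fin _ → Fin _
  leaf i = lookup (neighbours G v) (inject≤ i r≤deg)
  leaf-injective : Injective _≡_ _≡_ leaf
  leaf-injective {i} {j} eq = inject≤-injective r≤deg r≤deg i j
    (unique-lookup-injective (Unique.filter⁺ (T? ∘ adj G v) (Unique.allFin⁺ _)) _ _ eq)
  leaf-adjacent : ∀ k → T (adj G v (lookup (neighbours G v) k))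
  leaf-adjacent k = proj₂ (∈-filter⁻ (T? ∘ adj G v) {xs = allFin _} (∈-lookup k))

containsStar⇒≤deg : (G : Graph n) {r : ℕ} → ContainsStar r G → ∃[ v ] r ≤ deg G v
containsStar⇒≤deg G (v , leaf , leaf-injective , leaf-adjacent) = v , injective⇒≤ position-injective
  where
  leaf∈ : ∀ i → leaf i ∈ neighbours G v
  leaf∈ i = ∈-filter⁺ (T? ∘ adj G v) (∈-allFin (leaf i)) (leaf-adjacent i)
  position-injective : Injective _≡_ _≡_ (λ i → index (leaf∈ i))
  position-injective {i} {j} eq = leaf-injective
    (trans (lookup-index (leaf∈ i)) (trans (cong (lookup (neighbours G v)) eq) (sym (lookup-index (leaf∈ j)))))

starFree⇒maxDeg : (G : Graph n) {D : ℕ} → StarFree (suc D) G → MaxDeg G D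
starFree⇒maxDeg G {D} starFree v with deg G v ≤? D
... | yes deg≤D = deg≤D
... | no  deg≰D = ⊥-elim (starFree (≤deg⇒containsStar G v (≰⇒> deg≰D)))

maxDeg⇒starFree : (G : Graph n) {D : ℕ} → MaxDeg G D → StarFree (suc D) G
maxDeg⇒starFree G maxdeg star with containsStar⇒≤deg G star
... | v , D<deg = <⇒≱ D<deg (maxdeg v)

-- Deficient vertices

Addable : Graph n → ℕ → Set
Addable {n} G D = Σ[ u ∈ Fin n ] Σ[ v ∈ Fin n ]
  (¬ u ≡ v × deg G u < D × deg G v < D × adj G u v ≡ false)

addable? : (G : Graph n) (D : ℕ) → Dec (Addable G D)
addable? G D = any? λ u → any? λ v →
  ¬? (u ≟ v) ×-dec deg G u <? D ×-dec deg G v <? D ×-dec adj G u v ≟ᵇ false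

almostRegular? : (G : Graph n) (D : ℕ) → Dec (AlmostRegular G D)
almostRegular? G D = all? (λ v → deg G v ≟ℕ D) ⊎-dec
  any? (λ u → (deg G u + 1 ≟ℕ D) ×-dec all? (λ v → ¬? (v ≟ u) →-dec (deg G v ≟ℕ D)))

n*D≤∑deg+D*[1+D] : (G : Graph n) {D : ℕ} → MaxDeg G D → ¬ Addable G D → (u : Fin n) → deg G u < D →
  n * D ≤ ∑[ w < n ] deg G w + D * suc D
n*D≤∑deg+D*[1+D] {n} G {D} maxdeg saturated u deg-u<D = begin
  n * D                                                  ≡⟨ ∑-const n D ⟨
  ∑[ w < n ] D                                           ≤⟨ ∑-mono-≤ full-outside ⟩
  ∑[ w < n ] (deg G w + D * 𝟙 (closedNbhd G u w))        ≡⟨ ∑-distrib-+ (deg G) (λ w → D * 𝟙 (closedNbhd G u w)) ⟩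
  ∑[ w < n ] deg G w + ∑[ w < n ] (D * 𝟙 (closedNbhd G u w))
    ≡⟨ cong (sum (deg G) +_) (*-distribˡ-sum D (𝟙 ∘ closedNbhd G u)) ⟨
  ∑[ w < n ] deg G w + D * ∑[ w < n ] 𝟙 (closedNbhd G u w)
    ≤⟨ +-monoʳ-≤ (sum (deg G)) (*-monoʳ-≤ D (∑-closedNbhd≤ G maxdeg u)) ⟩
  ∑[ w < n ] deg G w + D * suc D ∎
  where
  open ≤-Reasoning
  full-outside : ∀ w → D ≤ deg G w + D * 𝟙 (closedNbhd G u w)
  full-outside w with closedNbhd G u w in w∉N[u]
  ... | true  = ≤-trans (≤-reflexive (sym (*-identityʳ D))) (m≤n+m (D * 1) (deg G w))
  ... | false with deg G w <? D
  ...   | no  deg-w≮D = ≤-trans (≮⇒≥ deg-w≮D) (m≤m+n (deg G w) (D * 0))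
  ...   | yes deg-w<D = ⊥-elim (saturated (u , w , u≢w , deg-u<D , deg-w<D , ∨-conicalʳ (eqᵇ w u) (adj G u w) w∉N[u]))
    where
    u≢w : ¬ u ≡ w
    u≢w u≡w = eqᵇ-false⇒≢ (∨-conicalˡ (eqᵇ w u) (adj G u w) w∉N[u]) (sym u≡w)

n*D≤∑deg+1 : (G : Graph n) {D : ℕ} → AlmostRegular G D → n * D ≤ ∑[ w < n ] deg G w + 1
n*D≤∑deg+1 {n} G {D} (inj₁ regular) = ≤-trans
  (≤-reflexive (trans (sym (∑-const n D)) (sum-cong-≗ (λ v → sym (regular v)))))
  (m≤m+n (sum (deg G)) 1)
n*D≤∑deg+1 {n} G {D} (inj₂ (u , deg-u+1≡D , regular-elsewhere)) = begin
  n * D                                         ≡⟨ ∑-const n D ⟨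
  ∑[ w < n ] D                                  ≤⟨ ∑-mono-≤ pointwise ⟩
  ∑[ w < n ] (deg G w + 𝟙 (eqᵇ w u))            ≡⟨ ∑-distrib-+ (deg G) (λ w → 𝟙 (eqᵇ w u)) ⟩
  ∑[ w < n ] deg G w + ∑[ w < n ] 𝟙 (eqᵇ w u)   ≡⟨ cong (sum (deg G) +_) (∑-𝟙-≡ u) ⟩
  ∑[ w < n ] deg G w + 1                        ∎
  where
  open ≤-Reasoning
  pointwise : ∀ w → D ≤ deg G w + 𝟙 (eqᵇ w u)
  pointwise w with w ≟ u
  ... | yes refl = ≤-reflexive (sym deg-u+1≡D)
  ... | no  w≢u  = ≤-trans (≤-reflexive (sym (regular-elsewhere w w≢u))) (m≤m+n (deg G w) 0)

-- u ≡ v is allowed and describes a vertex with room for two more edges.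
Room : Graph n → ℕ → Fin n → Fin n → Set
Room {n} G D u v = ∀ (w : Fin n) → deg G w + (𝟙 (eqᵇ w u) + 𝟙 (eqᵇ w v)) ≤ D

room-distinct : (G : Graph n) {D : ℕ} → MaxDeg G D → {u v : Fin n} → ¬ u ≡ v →
  deg G u < D → deg G v < D → Room G D u v
room-distinct G {D} maxdeg {u} {v} u≢v deg-u<D deg-v<D w with w ≟ u | w ≟ v
... | yes refl | yes w≡v = ⊥-elim (u≢v w≡v)
... | yes refl | no _    = subst (_≤ D) (+-comm 1 (deg G w)) deg-u<D
... | no _     | yes refl = subst (_≤ D) (+-comm 1 (deg G w)) deg-v<D
... | no _     | no _     = subst (_≤ D) (sym (+-identityʳ (deg G w))) (maxdeg w)

room-same : (G : Graph n) {D : ℕ} → MaxDeg G D → {u : Fin n} → deg G u + 2 ≤ D → Room G D u u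
room-same G {D} maxdeg {u} deg-u+2≤D w with w ≟ u
... | yes refl = deg-u+2≤D
... | no _     = subst (_≤ D) (sym (+-identityʳ (deg G w))) (maxdeg w)

deficient-room : (G : Graph n) {D : ℕ} → MaxDeg G D → ¬ AlmostRegular G D →
  Σ[ u ∈ Fin n ] Σ[ v ∈ Fin n ] (deg G u < D × Room G D u v)
deficient-room G {D} maxdeg irregular with any? (λ u → deg G u <? D)
... | no none = ⊥-elim (irregular (inj₁ (λ v → ≤-antisym (maxdeg v) (≮⇒≥ (λ lt → none (v , lt))))))
... | yes (u , deg-u<D) with any? (λ v → ¬? (v ≟ u) ×-dec deg G v <? D)
...   | yes (v , v≢u , deg-v<D) = u , v , deg-u<D , room-distinct G maxdeg (v≢u ∘ sym) deg-u<D deg-v<D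
...   | no only-u with deg G u + 1 ≟ℕ D
...     | yes deg-u+1≡D = ⊥-elim (irregular (inj₂ (u , deg-u+1≡D ,
            λ v v≢u → ≤-antisym (maxdeg v) (≮⇒≥ (λ lt → only-u (v , v≢u , lt))))))
...     | no  deg-u+1≢D = u , u , deg-u<D , room-same G maxdeg
            (subst (_≤ D) (+-comm 2 (deg G u)) (≤∧≢⇒< deg-u<D (deg-u+1≢D ∘ trans (+-comm (deg G u) 1))))

-- Adding and removing an edge

isPair : Fin n → Fin n → Fin n → Fin n → Bool
isPair u v i j = (eqᵇ i u ∧ eqᵇ j v) ∨ (eqᵇ i v ∧ eqᵇ j u)

isPair-sym : (u v i j : Fin n) → isPair u v i j ≡ isPair u v j i
isPair-sym u v i j = trans (∨-comm (eqᵇ i u ∧ eqᵇ j v) (eqᵇ i v ∧ eqᵇ j u))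
  (cong₂ _∨_ (∧-comm (eqᵇ i v) (eqᵇ j u)) (∧-comm (eqᵇ i u) (eqᵇ j v)))

isPair-true : {u v i j : Fin n} → isPair u v i j ≡ true → (i ≡ u × j ≡ v) ⊎ (i ≡ v × j ≡ u)
isPair-true {u = u} {v} {i} {j} h with i ≟ u | j ≟ v | i ≟ v | j ≟ u
... | yes i≡u | yes j≡v | _       | _       = inj₁ (i≡u , j≡v)
... | yes _   | no _    | yes i≡v | yes j≡u = inj₂ (i≡v , j≡u)
... | no _    | _       | yes i≡v | yes j≡u = inj₂ (i≡v , j≡u)
isPair-true () | yes _ | no _ | yes _ | no _
isPair-true () | yes _ | no _ | no _  | _
isPair-true () | no _  | _    | yes _ | no _
isPair-true () | no _  | _    | no _  | _

isPair-irrefl : {u v : Fin n} → ¬ u ≡ v → (i : Fin n) → isPair u v i i ≡ false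
isPair-irrefl {u = u} {v} u≢v i with isPair u v i i in p
... | false = refl
... | true with isPair-true {u = u} {v} {i} {i} p
...   | inj₁ (i≡u , i≡v) = ⊥-elim (u≢v (trans (sym i≡u) i≡v))
...   | inj₂ (i≡v , i≡u) = ⊥-elim (u≢v (trans (sym i≡u) i≡v))

isPair-miss : {u v j : Fin n} → ¬ j ≡ u → ¬ j ≡ v → (i : Fin n) → isPair u v i j ≡ false
isPair-miss {u = u} {v} j≢u j≢v i rewrite ≢⇒eqᵇ-false j≢u | ≢⇒eqᵇ-false j≢v =
  cong₂ _∨_ (∧-zeroʳ (eqᵇ i u)) (∧-zeroʳ (eqᵇ i v))

addEdge : Graph n → (u v : Fin n) → ¬ u ≡ v → Graph n
addEdge G u v u≢v = record
  { adj   = λ i j → adj G i j ∨ isPair u v i j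
  ; sym   = λ i j → cong₂ _∨_ (Graph.sym G i j) (isPair-sym u v i j)
  ; irref = λ i → cong₂ _∨_ (irref G i) (isPair-irrefl u≢v i) }

removeEdge : Graph n → (x y : Fin n) → Graph n
removeEdge G x y = record
  { adj   = λ i j → adj G i j ∧ not (isPair x y i j)
  ; sym   = λ i j → cong₂ (λ a b → a ∧ not b) (Graph.sym G i j) (isPair-sym x y i j)
  ; irref = λ i → cong (_∧ not (isPair x y i i)) (irref G i) }

_≈ᴳ_ : Graph n → Graph n → Set
G ≈ᴳ H = ∀ i j → adj G i j ≡ adj H i j

edges-cong : (G H : Graph n) → G ≈ᴳ H → edges G ≡ edges H
edges-cong {n} G H G≈H = filterᵇ-cong (λ (i , j) → cong ((i <ᶠ j) ∧_) (G≈H i j)) (allPairs n)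

deg-cong : (G H : Graph n) → G ≈ᴳ H → ∀ v → deg G v ≡ deg H v
deg-cong {n} G H G≈H v = cong length (filterᵇ-cong (G≈H v) (allFin n))

addEdge-removeEdge : (G : Graph n) {x y : Fin n} (x≢y : ¬ x ≡ y) → adj G x y ≡ true →
  addEdge (removeEdge G x y) x y x≢y ≈ᴳ G
addEdge-removeEdge G {x} {y} x≢y adj-xy i j with isPair x y i j in p
... | false = trans (∨-identityʳ _) (∧-identityʳ (adj G i j))
... | true with isPair-true {u = x} {y} {i} {j} p
...   | inj₁ (refl , refl) = trans (∨-zeroʳ _) (sym adj-xy)
...   | inj₂ (refl , refl) = trans (∨-zeroʳ _) (sym (trans (Graph.sym G y x) adj-xy))

∑-𝟙-isPair : {u v : Fin n} → ¬ u ≡ v → (w : Fin n) →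
  ∑[ j < n ] 𝟙 (isPair u v w j) ≡ 𝟙 (eqᵇ w u) + 𝟙 (eqᵇ w v)
∑-𝟙-isPair {n} {u} {v} u≢v w = begin
  ∑[ j < n ] 𝟙 (isPair u v w j)                                   ≡⟨ sum-cong-≗ split ⟩
  ∑[ j < n ] (𝟙 (eqᵇ w u) * 𝟙 (eqᵇ j v) + 𝟙 (eqᵇ w v) * 𝟙 (eqᵇ j u))
    ≡⟨ ∑-distrib-+ (λ j → 𝟙 (eqᵇ w u) * 𝟙 (eqᵇ j v)) (λ j → 𝟙 (eqᵇ w v) * 𝟙 (eqᵇ j u)) ⟩
  ∑[ j < n ] (𝟙 (eqᵇ w u) * 𝟙 (eqᵇ j v)) + ∑[ j < n ] (𝟙 (eqᵇ w v) * 𝟙 (eqᵇ j u))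
    ≡⟨ cong₂ _+_ (*-distribˡ-sum (𝟙 (eqᵇ w u)) (λ j → 𝟙 (eqᵇ j v)))
                 (*-distribˡ-sum (𝟙 (eqᵇ w v)) (λ j → 𝟙 (eqᵇ j u))) ⟨
  𝟙 (eqᵇ w u) * ∑[ j < n ] 𝟙 (eqᵇ j v) + 𝟙 (eqᵇ w v) * ∑[ j < n ] 𝟙 (eqᵇ j u)
    ≡⟨ cong₂ (λ a b → 𝟙 (eqᵇ w u) * a + 𝟙 (eqᵇ w v) * b) (∑-𝟙-≡ v) (∑-𝟙-≡ u) ⟩
  𝟙 (eqᵇ w u) * 1 + 𝟙 (eqᵇ w v) * 1
    ≡⟨ cong₂ _+_ (*-identityʳ (𝟙 (eqᵇ w u))) (*-identityʳ (𝟙 (eqᵇ w v))) ⟩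
  𝟙 (eqᵇ w u) + 𝟙 (eqᵇ w v) ∎
  where
  open ≡-Reasoning
  split : ∀ j → 𝟙 (isPair u v w j) ≡ 𝟙 (eqᵇ w u) * 𝟙 (eqᵇ j v) + 𝟙 (eqᵇ w v) * 𝟙 (eqᵇ j u)
  split j = trans (𝟙-∨-exclusive (eqᵇ w u ∧ eqᵇ j v) (eqᵇ w v ∧ eqᵇ j u)
                    (λ p q → u≢v (trans (sym (eqᵇ-true⇒≡ {a = w} (∧-conicalˡ (eqᵇ w u) (eqᵇ j v) p)))
                                        (eqᵇ-true⇒≡ {a = w} (∧-conicalˡ (eqᵇ w v) (eqᵇ j u) q)))))
                  (cong₂ _+_ (𝟙-∧ (eqᵇ w u) (eqᵇ j v)) (𝟙-∧ (eqᵇ w v) (eqᵇ j u)))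

¬adj-at-pair : (G : Graph n) {u v i j : Fin n} → adj G u v ≡ false → isPair u v i j ≡ true → adj G i j ≡ false
¬adj-at-pair G {u} {v} {i} {j} ¬adj-uv p with isPair-true {u = u} {v} {i} {j} p
... | inj₁ (refl , refl) = ¬adj-uv
... | inj₂ (refl , refl) = trans (Graph.sym G v u) ¬adj-uv

deg-addEdge : (G : Graph n) {u v : Fin n} (u≢v : ¬ u ≡ v) → adj G u v ≡ false → ∀ w →
  deg (addEdge G u v u≢v) w ≡ deg G w + (𝟙 (eqᵇ w u) + 𝟙 (eqᵇ w v))
deg-addEdge {n} G {u} {v} u≢v ¬adj-uv w = begin
  deg (addEdge G u v u≢v) w                            ≡⟨ deg≡∑ (addEdge G u v u≢v) w ⟩
  ∑[ j < n ] 𝟙 (adj G w j ∨ isPair u v w j)            ≡⟨ sum-cong-≗ (λ j → 𝟙-∨-exclusive (adj G w j) (isPair u v w j)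
                                                          (λ a p → true≢false (trans (sym a) (¬adj-at-pair G {i = w} ¬adj-uv p)))) ⟩
  ∑[ j < n ] (𝟙 (adj G w j) + 𝟙 (isPair u v w j))      ≡⟨ ∑-distrib-+ (λ j → 𝟙 (adj G w j)) (λ j → 𝟙 (isPair u v w j)) ⟩
  ∑[ j < n ] 𝟙 (adj G w j) + ∑[ j < n ] 𝟙 (isPair u v w j)
    ≡⟨ cong₂ _+_ (sym (deg≡∑ G w)) (∑-𝟙-isPair u≢v w) ⟩
  deg G w + (𝟙 (eqᵇ w u) + 𝟙 (eqᵇ w v)) ∎
  where
  open ≡-Reasoning
  true≢false : ¬ true ≡ false
  true≢false ()

sameEdge : Edge n → Edge n → Bool
sameEdge (i , j) (a , b) = eqᵇ i a ∧ eqᵇ j b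

sameEdge⇒≡ : {e f : Edge n} → sameEdge e f ≡ true → e ≡ f
sameEdge⇒≡ {e = i , j} {a , b} same =
  cong₂ _,_ (eqᵇ-true⇒≡ (∧-conicalˡ (eqᵇ i a) (eqᵇ j b) same))
            (eqᵇ-true⇒≡ (∧-conicalʳ (eqᵇ i a) (eqᵇ j b) same))

count-allPairs : (f : Edge n) → length (filterᵇ (λ e → sameEdge e f) (allPairs n)) ≡ 1
count-allPairs {n} (a , b) = begin
  length (filterᵇ (λ e → sameEdge e (a , b)) (allPairs n))
    ≡⟨ length-filterᵇ-allPairs (λ e → sameEdge e (a , b)) ⟩
  ∑[ i < n ] ∑[ j < n ] 𝟙 (eqᵇ i a ∧ eqᵇ j b)
    ≡⟨ sum-cong-≗ (λ i → sum-cong-≗ (λ j → 𝟙-∧ (eqᵇ i a) (eqᵇ j b))) ⟩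
  ∑[ i < n ] ∑[ j < n ] (𝟙 (eqᵇ i a) * 𝟙 (eqᵇ j b))
    ≡⟨ sum-cong-≗ (λ i → *-distribˡ-sum (𝟙 (eqᵇ i a)) (λ j → 𝟙 (eqᵇ j b))) ⟨
  ∑[ i < n ] (𝟙 (eqᵇ i a) * ∑[ j < n ] 𝟙 (eqᵇ j b))
    ≡⟨ sum-cong-≗ (λ i → trans (cong (𝟙 (eqᵇ i a) *_) (∑-𝟙-≡ b)) (*-identityʳ (𝟙 (eqᵇ i a)))) ⟩
  ∑[ i < n ] 𝟙 (eqᵇ i a)
    ≡⟨ ∑-𝟙-≡ a ⟩
  1 ∎
  where open ≡-Reasoning

ordered : Fin n → Fin n → Edge n
ordered u v = if u <ᶠ v then (u , v) else (v , u)

disjointEdges-ordered : (u v : Fin n) (e : Edge n) → disjointEdges (ordered u v) e ≡ disjointEdges (u , v) e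
disjointEdges-ordered u v e with u <ᶠ v
... | true  = refl
... | false = disjointEdges-flip u v e

isEdge-addEdge-ordered : (G : Graph n) {u v : Fin n} (u≢v : ¬ u ≡ v) →
  isEdge (addEdge G u v u≢v) (ordered u v) ≡ true
isEdge-addEdge-ordered G {u} {v} u≢v with compare u v
... | less u<v _ rewrite u<v | eqᵇ-refl u | eqᵇ-refl v | u<v = ∨-zeroʳ (adj G u v)
... | greater u≮v v<u rewrite u≮v | eqᵇ-refl u | eqᵇ-refl v | v<u =
  trans (cong (adj G v u ∨_) (∨-zeroʳ (eqᵇ v u ∧ eqᵇ u v))) (∨-zeroʳ (adj G v u))
... | equal u≡v = ⊥-elim (u≢v u≡v)

isEdge-ordered : (G : Graph n) {u v : Fin n} → ¬ u ≡ v → adj G u v ≡ false → isEdge G (ordered u v) ≡ false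
isEdge-ordered G {u} {v} u≢v ¬adj-uv with compare u v
... | less u<v _ rewrite u<v | u<v = ¬adj-uv
... | greater u≮v v<u rewrite u≮v | v<u = trans (Graph.sym G v u) ¬adj-uv
... | equal u≡v = ⊥-elim (u≢v u≡v)

isEdge-addEdge-elsewhere : (G : Graph n) {u v : Fin n} (u≢v : ¬ u ≡ v) (e : Edge n) →
  sameEdge e (ordered u v) ≡ false → isEdge (addEdge G u v u≢v) e ≡ isEdge G e
isEdge-addEdge-elsewhere G {u} {v} u≢v (i , j) elsewhere with i <ᶠ j in i<j
... | false = refl
... | true with isPair u v i j in p
...   | false = ∨-identityʳ (adj G i j)
...   | true with isPair-true {u = u} {v} {i} {j} p
...     | inj₁ (refl , refl) rewrite i<j | eqᵇ-refl i | eqᵇ-refl j with () ← elsewhere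
...     | inj₂ (refl , refl) with compare i j
...       | less _ j≮i rewrite j≮i | eqᵇ-refl i | eqᵇ-refl j with () ← elsewhere
...       | greater i≮j _ with () ← trans (sym i≮j) i<j
...       | equal i≡j = ⊥-elim (u≢v (sym i≡j))

edges-addEdge : (G : Graph n) {u v : Fin n} (u≢v : ¬ u ≡ v) → adj G u v ≡ false →
  Σ[ as ∈ List (Edge n) ] Σ[ bs ∈ List (Edge n) ]
    (edges G ≡ as ++ bs × edges (addEdge G u v u≢v) ≡ as ++ ordered u v ∷ bs)
edges-addEdge {n} G {u} {v} u≢v ¬adj-uv =
  filterᵇ-around sameEdge sameEdge⇒≡ (isEdge G) (isEdge (addEdge G u v u≢v)) (ordered u v) (allPairs n)
    (count-allPairs (ordered u v)) (λ e elsewhere → sym (isEdge-addEdge-elsewhere G u≢v e elsewhere))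
    (isEdge-ordered G u≢v ¬adj-uv) (isEdge-addEdge-ordered G u≢v)

matchings-addEdge : (k : ℕ) (G : Graph n) {u v : Fin n} (u≢v : ¬ u ≡ v) → adj G u v ≡ false →
  matchings (suc k) (edges (addEdge G u v u≢v))
    ≡ matchings (suc k) (edges G) + matchings k (avoiding (u , v) (edges G))
matchings-addEdge k G {u} {v} u≢v ¬adj-uv with edges-addEdge G u≢v ¬adj-uv
... | as , bs , old , new rewrite old | new =
  trans (matchings-insert k as bs (ordered u v))
        (cong (λ es → matchings (suc k) (as ++ bs) + matchings k es)
              (filterᵇ-cong (disjointEdges-ordered u v) (as ++ bs)))

avoiding-addEdge : (G : Graph n) {u v : Fin n} (u≢v : ¬ u ≡ v) → adj G u v ≡ false →
  avoiding (u , v) (edges (addEdge G u v u≢v)) ≡ avoiding (u , v) (edges G)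
avoiding-addEdge G {u} {v} u≢v ¬adj-uv with edges-addEdge G u≢v ¬adj-uv
... | as , bs , old , new rewrite old | new = begin
  avoiding (u , v) (as ++ ordered u v ∷ bs)            ≡⟨ filter-++ (T? ∘ disjointEdges (u , v)) as _ ⟩
  avoiding (u , v) as ++ avoiding (u , v) (ordered u v ∷ bs)
    ≡⟨ cong (avoiding (u , v) as ++_) (filterᵇ-reject (disjointEdges (u , v)) bs uv-meets-itself) ⟩
  avoiding (u , v) as ++ avoiding (u , v) bs           ≡⟨ filter-++ (T? ∘ disjointEdges (u , v)) as bs ⟨
  avoiding (u , v) (as ++ bs)                          ∎
  where
  open ≡-Reasoning
  uv-meets-itself : disjointEdges (u , v) (ordered u v) ≡ false
  uv-meets-itself = trans (disjointEdges-sym (u , v) (ordered u v))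
    (trans (disjointEdges-ordered u v (u , v)) (disjointEdges-irrefl (u , v)))

edges-⊆-addEdge : (G : Graph n) {u v : Fin n} (u≢v : ¬ u ≡ v) → adj G u v ≡ false →
  edges G ⊆ edges (addEdge G u v u≢v)
edges-⊆-addEdge G {u} {v} u≢v ¬adj-uv with edges-addEdge G u≢v ¬adj-uv
... | as , bs , old , new rewrite old | new = ++⁺ ⊆-refl (ordered u v ∷ʳ ⊆-refl)

#edges-addEdge : (G : Graph n) {u v : Fin n} (u≢v : ¬ u ≡ v) → adj G u v ≡ false →
  #edges (addEdge G u v u≢v) ≡ suc (#edges G)
#edges-addEdge G {u} {v} u≢v ¬adj-uv with edges-addEdge G u≢v ¬adj-uv
... | as , bs , old , new rewrite old | new = length-++-sucʳ as (ordered u v) bs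

module Switch (G : Graph n) {u v : Fin n} (far : FarEdge G u v) where
  open FarEdge far

  G₀ G₁ switched : Graph n
  G₀       = removeEdge G x y
  G₁       = addEdge G₀ v y (y≢v ∘ sym)
  switched = addEdge G₁ u x (x≢u ∘ sym)

  ¬adj₀-xy : adj G₀ x y ≡ false
  ¬adj₀-xy rewrite eqᵇ-refl x | eqᵇ-refl y = ∧-zeroʳ (adj G x y)

  ¬adj₀-vy : adj G₀ v y ≡ false
  ¬adj₀-vy = cong (_∧ not (isPair x y v y)) ¬adj-vy

  ¬adj₁-ux : adj G₁ u x ≡ false
  ¬adj₁-ux = cong₂ _∨_ (cong (_∧ not (isPair x y u x)) ¬adj-ux) (isPair-miss x≢v x≢y u)

  G₀+xy≈G : addEdge G₀ x y x≢y ≈ᴳ G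
  G₀+xy≈G = addEdge-removeEdge G x≢y adj-xy

  deg-switched : ∀ w → deg switched w ≡ deg G w + (𝟙 (eqᵇ w u) + 𝟙 (eqᵇ w v))
  deg-switched w = begin
    deg switched w                        ≡⟨ deg-addEdge G₁ (x≢u ∘ sym) ¬adj₁-ux w ⟩
    deg G₁ w + (U + X)                    ≡⟨ cong (_+ (U + X)) (deg-addEdge G₀ (y≢v ∘ sym) ¬adj₀-vy w) ⟩
    (deg G₀ w + (V + Y)) + (U + X)        ≡⟨ rearrange (deg G₀ w) U V X Y ⟩
    (deg G₀ w + (X + Y)) + (U + V)        ≡⟨ cong (_+ (U + V)) (deg-addEdge G₀ x≢y ¬adj₀-xy w) ⟨
    deg (addEdge G₀ x y x≢y) w + (U + V)  ≡⟨ cong (_+ (U + V)) (deg-cong (addEdge G₀ x y x≢y) G G₀+xy≈G w) ⟩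
    deg G w + (U + V)                     ∎
    where
    open ≡-Reasoning
    U = 𝟙 (eqᵇ w u)
    V = 𝟙 (eqᵇ w v)
    X = 𝟙 (eqᵇ w x)
    Y = 𝟙 (eqᵇ w y)
    rearrange : ∀ d U V X Y → (d + (V + Y)) + (U + X) ≡ (d + (X + Y)) + (U + V)
    rearrange = solve-∀

  avoiding-xy : List (Edge n)
  avoiding-xy = avoiding (x , y) (edges G)

  avoiding-xy≡ : avoiding (x , y) (edges G₀) ≡ avoiding-xy
  avoiding-xy≡ = trans (sym (avoiding-addEdge G₀ x≢y ¬adj₀-xy))
                       (cong (avoiding (x , y)) (edges-cong (addEdge G₀ x y x≢y) G G₀+xy≈G))

  avoiding-xy⊆ : avoiding-xy ⊆ edges G₀
  avoiding-xy⊆ = subst (_⊆ edges G₀) avoiding-xy≡ (avoiding-⊆ (x , y) (edges G₀))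

  avoiding-u-xy⊆ : avoiding (u , u) avoiding-xy ⊆ avoiding (u , x) (edges G₁)
  avoiding-u-xy⊆ = ⊆-trans
    (subst (λ es → avoiding (u , u) es ⊆ avoiding (u , x) (edges G₀)) avoiding-xy≡ (avoiding-avoiding-⊆ u x y (edges G₀)))
    (avoiding⁺ (u , x) (edges-⊆-addEdge G₀ (y≢v ∘ sym) ¬adj₀-vy))

  matchings-G : ∀ k → matchings (suc k) (edges G) ≡ matchings (suc k) (edges G₀) + matchings k avoiding-xy
  matchings-G k = begin
    matchings (suc k) (edges G)                                             ≡⟨ cong (matchings (suc k)) (edges-cong (addEdge G₀ x y x≢y) G G₀+xy≈G) ⟨
    matchings (suc k) (edges (addEdge G₀ x y x≢y))                          ≡⟨ matchings-addEdge k G₀ x≢y ¬adj₀-xy ⟩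
    matchings (suc k) (edges G₀) + matchings k (avoiding (x , y) (edges G₀)) ≡⟨ cong (λ es → matchings (suc k) (edges G₀) + matchings k es) avoiding-xy≡ ⟩
    matchings (suc k) (edges G₀) + matchings k avoiding-xy                  ∎
    where open ≡-Reasoning

  matchings-switched : ∀ k → matchings (suc k) (edges switched)
    ≡ (matchings (suc k) (edges G₀) + matchings k (avoiding (v , y) (edges G₀))) + matchings k (avoiding (u , x) (edges G₁))
  matchings-switched k = trans (matchings-addEdge k G₁ (x≢u ∘ sym) ¬adj₁-ux)
    (cong (_+ matchings k (avoiding (u , x) (edges G₁))) (matchings-addEdge k G₀ (y≢v ∘ sym) ¬adj₀-vy))

-- Asymptotics

conflicts : ℕ → ℕ
conflicts D = D * 2 + D * 2

-- Covers the deficit in both n*D≤∑deg+D*[1+D] and n*D≤∑deg+1.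
slack : ℕ → ℕ
slack D = D * suc D + 1

blockSize : ℕ → ℕ → ℕ
blockSize D s = suc (4 * (s * suc (conflicts D)))

gainFactor : ℕ → ℕ → ℕ
gainFactor D s = 2 * (2 * blockSize D s) ^ s

threshold : ℕ → ℕ → ℕ
threshold D s = blockSize D s + 2 * (4 * conflicts D + slack D)
              + gainFactor D s * conflicts D * D ^ (s ∸ 1) + (2 * suc (farEdgeThreshold D) + slack D)

1≤gainFactor : ∀ D s → 1 ≤ gainFactor D s
1≤gainFactor D s = ≤-trans (s≤s z≤n) (*-monoʳ-≤ 2 (m^n>0 (2 * blockSize D s) s))

[m*n]^k≡m^k*n^k : ∀ m n k → (m * n) ^ k ≡ m ^ k * n ^ k
[m*n]^k≡m^k*n^k m n zero    = refl
[m*n]^k≡m^k*n^k m n (suc k) rewrite [m*n]^k≡m^k*n^k m n k = rearrange m n (m ^ k) (n ^ k)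
  where
  rearrange : ∀ m n x y → m * n * (x * y) ≡ m * x * (n * y)
  rearrange = solve-∀

-- b = n / blockSize D s is the number of choices guaranteed at each of the s steps of the
-- greedy count in matchings-lower; the four summands of threshold are the lower bounds on n
-- behind M≤n, greedy-room, atVertex-negligible and far-room.
module Asymptotics (D s n : ℕ) (1≤D : 1 ≤ D) (n≥N₀ : threshold D s ≤ n) where

  β c₀ M K b : ℕ
  β  = conflicts D
  c₀ = slack D
  M  = blockSize D s
  K  = gainFactor D s
  b  = n / M

  atVertexBound : ℕ → ℕ
  atVertexBound zero    = 0
  atVertexBound (suc k) = β * (n * D) ^ k

  private
    t₁ t₂ t₃ t₄ : ℕ
    t₁ = M
    t₂ = 2 * (4 * β + c₀)
    t₃ = K * β * D ^ (s ∸ 1)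
    t₄ = 2 * suc (farEdgeThreshold D) + c₀
    t₁+t₂+t₃≤n : t₁ + t₂ + t₃ ≤ n
    t₁+t₂+t₃≤n = ≤-trans (m≤m+n (t₁ + t₂ + t₃) t₄) n≥N₀
    M≤n : M ≤ n
    M≤n = ≤-trans (m≤m+n t₁ t₂) (≤-trans (m≤m+n (t₁ + t₂) t₃) t₁+t₂+t₃≤n)
    t₂≤n : t₂ ≤ n
    t₂≤n = ≤-trans (m≤n+m t₂ t₁) (≤-trans (m≤m+n (t₁ + t₂) t₃) t₁+t₂+t₃≤n)
    t₃≤n : t₃ ≤ n
    t₃≤n = ≤-trans (m≤n+m t₃ (t₁ + t₂)) t₁+t₂+t₃≤n
    t₄≤n : t₄ ≤ n
    t₄≤n = ≤-trans (m≤n+m t₄ (t₁ + t₂ + t₃)) n≥N₀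
    n≤n*D : n ≤ n * D
    n≤n*D = ≤-trans (≤-reflexive (sym (*-identityʳ n))) (*-monoʳ-≤ n 1≤D)

  1≤b : 1 ≤ b
  1≤b with b in b≡
  ... | suc _ = s≤s z≤n
  ... | zero  = ⊥-elim (<⇒≱ (≤-<-trans n≤n%M (m%n<n n M)) M≤n)
    where
    n≤n%M : n ≤ n % M
    n≤n%M = ≤-reflexive (trans (m≡m%n+[m/n]*n n M) (trans (cong (λ z → n % M + z * M) b≡) (+-identityʳ (n % M))))

  n≤2M*b : n ≤ (2 * M) * b
  n≤2M*b = begin
    n               ≡⟨ m≡m%n+[m/n]*n n M ⟩
    n % M + b * M   ≤⟨ +-monoˡ-≤ (b * M) (<⇒≤ (m%n<n n M)) ⟩
    M + b * M       ≤⟨ +-monoˡ-≤ (b * M) (≤-trans (≤-reflexive (sym (*-identityˡ M))) (*-monoˡ-≤ M 1≤b)) ⟩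
    b * M + b * M   ≡⟨ rearrange b M ⟩
    (2 * M) * b     ∎
    where
    open ≤-Reasoning
    rearrange : ∀ b M → b * M + b * M ≡ (2 * M) * b
    rearrange = solve-∀

  greedy-room : ∀ L → n * D ≤ (L + (β + β)) + (L + (β + β)) + c₀ → (s * b) * suc β ≤ L
  greedy-room L dense = *-cancelˡ-≤ 4 (+-cancelʳ-≤ (8 * β + 2 * c₀) (4 * X) (4 * L) chain)
    where
    X = (s * b) * suc β
    4X≤n : 4 * X ≤ n
    4X≤n = begin
      4 * X                       ≡⟨ rearrange₁ s b β ⟩
      4 * ((s * suc β) * b)       ≤⟨ m≤n+m _ b ⟩
      b + 4 * ((s * suc β) * b)   ≡⟨ rearrange₂ b (s * suc β) ⟩
      b * M                       ≤⟨ m/n*n≤m n M ⟩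
      n                           ∎
      where
      open ≤-Reasoning
      rearrange₁ : ∀ s b β → 4 * ((s * b) * suc β) ≡ 4 * ((s * suc β) * b)
      rearrange₁ = solve-∀
      rearrange₂ : ∀ b Q → b + 4 * (Q * b) ≡ b * suc (4 * Q)
      rearrange₂ = solve-∀
    chain : 4 * X + (8 * β + 2 * c₀) ≤ 4 * L + (8 * β + 2 * c₀)
    chain = begin
      4 * X + (8 * β + 2 * c₀)  ≡⟨ cong (4 * X +_) (rearrange₁ β c₀) ⟩
      4 * X + t₂                ≤⟨ +-mono-≤ 4X≤n t₂≤n ⟩
      n + n                     ≤⟨ +-mono-≤ n≤n*D n≤n*D ⟩
      n * D + n * D             ≤⟨ +-mono-≤ dense dense ⟩
      ((L + (β + β)) + (L + (β + β)) + c₀) + ((L + (β + β)) + (L + (β + β)) + c₀)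
                                ≡⟨ rearrange₂ L β c₀ ⟩
      4 * L + (8 * β + 2 * c₀)  ∎
      where
      open ≤-Reasoning
      rearrange₁ : ∀ β c₀ → 8 * β + 2 * c₀ ≡ 2 * (4 * β + c₀)
      rearrange₁ = solve-∀
      rearrange₂ : ∀ L β c₀ → ((L + (β + β)) + (L + (β + β)) + c₀) + ((L + (β + β)) + (L + (β + β)) + c₀)
                              ≡ 4 * L + (8 * β + 2 * c₀)
      rearrange₂ = solve-∀

  atVertex-negligible : K * atVertexBound s + n ^ s ≤ K * b ^ s
  atVertex-negligible = go s refl
    where
    go : ∀ s′ → s′ ≡ s → K * atVertexBound s′ + n ^ s′ ≤ K * b ^ s′
    go zero    _    = ≤-trans (≤-reflexive (cong (_+ 1) (*-zeroʳ K)))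
                              (≤-trans (1≤gainFactor D s) (≤-reflexive (sym (*-identityʳ K))))
    go (suc k) refl = begin
      K * (β * (n * D) ^ k) + n * n ^ k                         ≤⟨ +-monoˡ-≤ (n * n ^ k) atVertex≤ ⟩
      n * n ^ k + n * n ^ k                                     ≤⟨ +-mono-≤ n^[1+k]≤ n^[1+k]≤ ⟩
      (2 * M) ^ suc k * b ^ suc k + (2 * M) ^ suc k * b ^ suc k ≡⟨ rearrange ((2 * M) ^ suc k) (b ^ suc k) ⟩
      K * b ^ suc k                                             ∎
      where
      open ≤-Reasoning
      rearrange : ∀ x y → x * y + x * y ≡ (2 * x) * y
      rearrange = solve-∀
      atVertex≤ : K * (β * (n * D) ^ k) ≤ n * n ^ k
      atVertex≤ = begin
        K * (β * (n * D) ^ k)      ≡⟨ cong (λ z → K * (β * z)) ([m*n]^k≡m^k*n^k n D k) ⟩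
        K * (β * (n ^ k * D ^ k))  ≡⟨ rearrange′ K β (n ^ k) (D ^ k) ⟩
        (K * β * D ^ k) * n ^ k    ≤⟨ *-monoˡ-≤ (n ^ k) t₃≤n ⟩
        n * n ^ k                  ∎
        where
        rearrange′ : ∀ K β x y → K * (β * (x * y)) ≡ (K * β * y) * x
        rearrange′ = solve-∀
      n^[1+k]≤ : n * n ^ k ≤ (2 * M) ^ suc k * b ^ suc k
      n^[1+k]≤ = ≤-trans (^-monoˡ-≤ (suc k) n≤2M*b) (≤-reflexive ([m*n]^k≡m^k*n^k (2 * M) b (suc k)))

  n^s≤K*b^s : n ^ s ≤ K * b ^ s
  n^s≤K*b^s = ≤-trans (m≤n+m (n ^ s) (K * atVertexBound s)) atVertex-negligible

  far-room : ∀ e → n * D ≤ e + e + c₀ → farEdgeThreshold D < e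
  far-room e dense = *-cancelˡ-≤ 2 (+-cancelʳ-≤ c₀ (2 * suc (farEdgeThreshold D)) (2 * e)
    (≤-trans t₄≤n (≤-trans n≤n*D (≤-trans dense (≤-reflexive (cong (_+ c₀) (rearrange e)))))))
    where
    rearrange : ∀ e → e + e ≡ 2 * e
    rearrange = solve-∀

+-*-arrangement : ∀ K C X Y Z₁ Z₂ m N B → X ≤ Y + m → Y ≤ Z₂ → B ≤ Z₁ → K * m + N ≤ K * B →
  K * (C + X) + N ≤ K * ((C + Z₁) + Z₂)
+-*-arrangement K C X Y Z₁ Z₂ m N B X≤Y+m Y≤Z₂ B≤Z₁ m-negligible = begin
  K * (C + X) + N                 ≤⟨ +-monoˡ-≤ N (*-monoʳ-≤ K (+-monoʳ-≤ C X≤Y+m)) ⟩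
  K * (C + (Y + m)) + N           ≡⟨ rearrange₁ K C Y m N ⟩
  K * C + K * Y + (K * m + N)     ≤⟨ +-mono-≤ (+-monoʳ-≤ (K * C) (*-monoʳ-≤ K Y≤Z₂))
                                              (≤-trans m-negligible (*-monoʳ-≤ K B≤Z₁)) ⟩
  K * C + K * Z₂ + K * Z₁         ≡⟨ rearrange₂ K C Z₁ Z₂ ⟩
  K * ((C + Z₁) + Z₂)             ∎
  where
  open ≤-Reasoning
  rearrange₁ : ∀ K C Y m N → K * (C + (Y + m)) + N ≡ K * C + K * Y + (K * m + N)
  rearrange₁ = solve-∀
  rearrange₂ : ∀ K C Z₁ Z₂ → K * C + K * Z₂ + K * Z₁ ≡ K * ((C + Z₁) + Z₂)
  rearrange₂ = solve-∀

-- Improving an irregular graph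

module Improvement (D s n : ℕ) (1≤D : 1 ≤ D) (n≥N₀ : threshold D s ≤ n) where
  open Asymptotics D s n 1≤D n≥N₀

  Gain : Graph n → Graph n → Set
  Gain G H = K * matchings (suc s) (edges G) + n ^ s ≤ K * matchings (suc s) (edges H)

  Dense : Graph n → Set
  Dense G = n * D ≤ ∑[ v < n ] deg G v + c₀

  many-matchings : (G : Graph n) → MaxDeg G D → Dense G → (f g : Edge n) →
    b ^ s ≤ matchings s (avoiding g (avoiding f (edges G)))
  many-matchings G maxdeg dense f g = go s refl
    where
    L = avoiding g (avoiding f (edges G))
    meets : MeetsAtMost β (edges G)
    meets = edges-MeetsAtMost G maxdeg
    #edges≤L : #edges G ≤ length L + (β + β)
    #edges≤L = ≤-trans (length≤length-avoiding+ {es = edges G} meets f)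
      (≤-trans (+-monoˡ-≤ β (length≤length-avoiding+ {es = avoiding f (edges G)}
                               (MeetsAtMost-⊆ {fs = edges G} (avoiding-⊆ f (edges G)) meets) g))
               (≤-reflexive (+-assoc (length L) β β)))
    dense′ : n * D ≤ (length L + (β + β)) + (length L + (β + β)) + c₀
    dense′ = ≤-trans dense (+-monoˡ-≤ c₀ (≤-trans (≤-reflexive (handshake G)) (+-mono-≤ #edges≤L #edges≤L)))
    go : ∀ s′ → s′ ≡ s → b ^ s′ ≤ matchings s′ L
    go zero    _    = ≤-refl
    go (suc k) refl = matchings-lower k b β b L
      (MeetsAtMost-⊆ {fs = edges G} (⊆-trans (avoiding-⊆ g (avoiding f (edges G))) (avoiding-⊆ f (edges G)))
                     (λ e → m≤n⇒m≤1+n (meets e)))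
      (greedy-room (length L) dense′)

  gain-addEdge : (G : Graph n) {u v : Fin n} (u≢v : ¬ u ≡ v) (¬adj-uv : adj G u v ≡ false) →
    MaxDeg (addEdge G u v u≢v) D → AlmostRegular (addEdge G u v u≢v) D → Gain G (addEdge G u v u≢v)
  gain-addEdge G {u} {v} u≢v ¬adj-uv maxdeg₁ regular₁ = begin
    K * matchings (suc s) (edges G) + n ^ s
      ≤⟨ +-monoʳ-≤ (K * matchings (suc s) (edges G)) (≤-trans n^s≤K*b^s (*-monoʳ-≤ K b^s≤new)) ⟩
    K * matchings (suc s) (edges G) + K * new ≡⟨ *-distribˡ-+ K (matchings (suc s) (edges G)) new ⟨
    K * (matchings (suc s) (edges G) + new) ≡⟨ cong (K *_) (matchings-addEdge s G u≢v ¬adj-uv) ⟨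
    K * matchings (suc s) (edges G₁)        ∎
    where
    open ≤-Reasoning
    G₁ = addEdge G u v u≢v
    new = matchings s (avoiding (u , v) (edges G))
    dense₁ : Dense G₁
    dense₁ = ≤-trans (n*D≤∑deg+1 G₁ regular₁) (+-monoʳ-≤ (sum (deg G₁)) (m≤n+m 1 (D * suc D)))
    b^s≤new : b ^ s ≤ new
    b^s≤new = ≤-trans (many-matchings G₁ maxdeg₁ dense₁ (u , v) (u , v))
      (≤-trans (matchings-mono s (avoiding-⊆ (u , v) (avoiding (u , v) (edges G₁))))
               (≤-reflexive (cong (matchings s) (avoiding-addEdge G u≢v ¬adj-uv))))

  -- avoiding (u , u) keeps the edges not incident with u.
  matchings-at-vertex : (G : Graph n) → MaxDeg G D → (u : Fin n) (es : List (Edge n)) → es ⊆ edges G →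
    matchings s es ≤ matchings s (avoiding (u , u) es) + atVertexBound s
  matchings-at-vertex G maxdeg u es es⊆ = go s refl
    where
    go : ∀ s′ → s′ ≡ s → matchings s′ es ≤ matchings s′ (avoiding (u , u) es) + atVertexBound s′
    go zero    _    = ≤-refl
    go (suc k) refl = ≤-trans (matchings-filterᵇ k (disjointEdges (u , u)) es)
      (+-monoʳ-≤ (matchings (suc k) (avoiding (u , u) es))
        (*-mono-≤ (MeetsAtMost-⊆ es⊆ (edges-MeetsAtMost G maxdeg) (u , u))
                  (^-monoˡ-≤ k (≤-trans (length-mono-≤ es⊆) (#edges≤ G maxdeg)))))

  switch : (G : Graph n) → MaxDeg G D → Dense G → {u v : Fin n} → Room G D u v → FarEdge G u v →
    Σ[ H ∈ Graph n ] (MaxDeg H D × Gain G H)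
  switch G maxdeg dense {u} {v} room far =
    switched , (λ w → subst (_≤ D) (sym (deg-switched w)) (room w)) ,
    subst₂ (λ old new → K * old + n ^ s ≤ K * new) (sym (matchings-G s)) (sym (matchings-switched s))
      (+-*-arrangement K (matchings (suc s) (edges G₀)) lost kept gained-vy gained-ux (atVertexBound s) (n ^ s) (b ^ s)
        (matchings-at-vertex G maxdeg u avoiding-xy (avoiding-⊆ (x , y) (edges G)))
        (matchings-mono s avoiding-u-xy⊆)
        (≤-trans (many-matchings G maxdeg dense (x , y) (v , y)) (matchings-mono s (avoiding⁺ (v , y) avoiding-xy⊆)))
        atVertex-negligible)
    where
    open FarEdge far
    open Switch G far
    lost      = matchings s avoiding-xy
    kept      = matchings s (avoiding (u , u) avoiding-xy)
    gained-vy = matchings s (avoiding (v , y) (edges G₀))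
    gained-ux = matchings s (avoiding (u , x) (edges G₁))

  -- fuel bounds the number of edges that can still be added.
  improve : (fuel : ℕ) (G : Graph n) → MaxDeg G D → ¬ AlmostRegular G D → length (allPairs n) ≤ #edges G + fuel →
    Σ[ H ∈ Graph n ] (MaxDeg H D × Gain G H)
  improve fuel G maxdeg irregular enough-fuel with addable? G D
  ... | yes (u , v , u≢v , deg-u<D , deg-v<D , ¬adj-uv) = extend (almostRegular? G₁ D) fuel enough-fuel
    where
    G₁ = addEdge G u v u≢v
    maxdeg₁ : MaxDeg G₁ D
    maxdeg₁ w = subst (_≤ D) (sym (deg-addEdge G u≢v ¬adj-uv w)) (room-distinct G maxdeg u≢v deg-u<D deg-v<D w)
    extend : Dec (AlmostRegular G₁ D) → ∀ fuel → length (allPairs n) ≤ #edges G + fuel →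
      Σ[ H ∈ Graph n ] (MaxDeg H D × Gain G H)
    extend (yes regular₁) _ _ = G₁ , maxdeg₁ , gain-addEdge G u≢v ¬adj-uv maxdeg₁ regular₁
    extend (no irregular₁) zero enough-fuel = ⊥-elim (1+n≰n (begin
      suc (#edges G)      ≡⟨ #edges-addEdge G u≢v ¬adj-uv ⟨
      #edges G₁           ≤⟨ #edges≤#allPairs G₁ ⟩
      length (allPairs n) ≤⟨ enough-fuel ⟩
      #edges G + 0        ≡⟨ +-identityʳ (#edges G) ⟩
      #edges G            ∎))
      where open ≤-Reasoning
    extend (no irregular₁) (suc fuel) enough-fuel with improve fuel G₁ maxdeg₁ irregular₁
      (≤-trans enough-fuel (≤-reflexive (trans (+-suc (#edges G) fuel) (cong (_+ fuel) (sym (#edges-addEdge G u≢v ¬adj-uv))))))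
    ... | H , maxdeg-H , gain-H = H , maxdeg-H ,
      ≤-trans (+-monoˡ-≤ (n ^ s) (*-monoʳ-≤ K (matchings-mono (suc s) (edges-⊆-addEdge G u≢v ¬adj-uv)))) gain-H
  ... | no saturated with deficient-room G maxdeg irregular
  ...   | u , v , deg-u<D , room = switch G maxdeg dense room
            (farEdge G maxdeg u v (far-room (#edges G) (≤-trans dense (≤-reflexive (cong (_+ c₀) (handshake G))))))
    where
    dense : Dense G
    dense = ≤-trans (n*D≤∑deg+D*[1+D] G maxdeg saturated u deg-u<D)
      (≤-trans (m≤m+n _ 1) (≤-reflexive (+-assoc (sum (deg G)) (D * suc D) 1)))

irregular-improvable : ∀ D s n → threshold D s ≤ n → (G : Graph n) → MaxDeg G D → ¬ AlmostRegular G D →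
  Σ[ H ∈ Graph n ] (MaxDeg H D ×
    gainFactor D s * matchings (suc s) (edges G) + n ^ s ≤ gainFactor D s * matchings (suc s) (edges H))
irregular-improvable D s n n≥N₀ G maxdeg irregular =
  Improvement.improve D s n 1≤D n≥N₀ (length (allPairs n)) G maxdeg irregular (m≤n+m _ (#edges G))
  where
  1≤D : 1 ≤ D
  1≤D with _ , _ , deg-u<D , _ ← deficient-room G maxdeg irregular = ≤-trans (s≤s z≤n) deg-u<D

-- Extremal graphs

-- Functions are compared pointwise, as there is no function extensionality.
HasMaximum : (A : Set) → (A → A → Set) → Set
HasMaximum A _≈_ = (c : A → ℕ) → (∀ a a′ → a ≈ a′ → c a ≡ c a′) → Σ[ g ∈ A ] ∀ a → c a ≤ c g

Bool-hasMaximum : HasMaximum Bool _≡_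
Bool-hasMaximum c _ with c false ≤? c true
... | yes f≤t = true  , λ { true → ≤-refl ; false → f≤t }
... | no  f≰t = false , λ { true → <⇒≤ (≰⇒> f≰t) ; false → ≤-refl }

Pointwise : {A : Set} → (A → A → Set) → ∀ m → (Fin m → A) → (Fin m → A) → Set
Pointwise R m f g = ∀ i → R (f i) (g i)

Π-hasMaximum : {R : A → A → Set} → (∀ a → R a a) → (∀ a a′ → R a a′ → R a′ a) → HasMaximum A R →
  ∀ m → HasMaximum (Fin m → A) (Pointwise R m)
Π-hasMaximum R-refl R-sym max-A zero    c c-inv = (λ ()) , λ f → ≤-reflexive (c-inv f (λ ()) (λ ()))
Π-hasMaximum {A = A} {R} R-refl R-sym max-A (suc m) c c-inv = best , best-max
  where
  c-inv-tail : ∀ a g g′ → Pointwise R m g g′ → c (a ∷ᶠ g) ≡ c (a ∷ᶠ g′)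
  c-inv-tail a g g′ g≈g′ = c-inv (a ∷ᶠ g) (a ∷ᶠ g′) λ { zero → R-refl a ; (suc i) → g≈g′ i }
  best-tail : ∀ a → Σ[ g ∈ (Fin m → A) ] ∀ g′ → c (a ∷ᶠ g′) ≤ c (a ∷ᶠ g)
  best-tail a = Π-hasMaximum R-refl R-sym max-A m (λ g → c (a ∷ᶠ g)) (c-inv-tail a)
  d : A → ℕ
  d a = c (a ∷ᶠ proj₁ (best-tail a))
  d-mono : ∀ a a′ → R a a′ → d a ≤ d a′
  d-mono a a′ a≈a′ = ≤-trans
    (≤-reflexive (c-inv (a ∷ᶠ proj₁ (best-tail a)) (a′ ∷ᶠ proj₁ (best-tail a))
                        λ { zero → a≈a′ ; (suc i) → R-refl _ }))
    (proj₂ (best-tail a′) (proj₁ (best-tail a)))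
  best-head = max-A d (λ a a′ a≈a′ → ≤-antisym (d-mono a a′ a≈a′) (d-mono a′ a (R-sym a a′ a≈a′)))
  best : Fin (suc m) → A
  best = proj₁ best-head ∷ᶠ proj₁ (best-tail (proj₁ best-head))
  best-max : ∀ f → c f ≤ c best
  best-max f = ≤-trans (≤-reflexive (c-inv f (f zero ∷ᶠ (f ∘ suc)) λ { zero → R-refl _ ; (suc i) → R-refl _ }))
    (≤-trans (proj₂ (best-tail (f zero)) (f ∘ suc)) (proj₂ best-head (f zero)))

-- Graph n carries proofs, so the maximum is taken over raw adjacency functions.
toGraph : (Fin n → Fin n → Bool) → Graph n
toGraph F = record
  { adj   = λ i j → (F i j ∧ F j i) ∧ not (eqᵇ i j)
  ; sym   = λ i j → cong₂ (λ a b → a ∧ not b) (∧-comm (F i j) (F j i)) (eqᵇ-sym i j)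
  ; irref = λ i → trans (cong (λ b → (F i i ∧ F i i) ∧ not b) (eqᵇ-refl i)) (∧-zeroʳ _) }

toGraph-cong : (F F′ : Fin n → Fin n → Bool) → Pointwise (Pointwise _≡_ n) n F F′ → toGraph F ≈ᴳ toGraph F′
toGraph-cong F F′ F≡F′ i j = cong₂ (λ a b → (a ∧ b) ∧ not (eqᵇ i j)) (F≡F′ i j) (F≡F′ j i)

toGraph-adj : (G : Graph n) → toGraph (adj G) ≈ᴳ G
toGraph-adj G i j with i ≟ j
... | yes refl = trans (∧-zeroʳ _) (sym (irref G i))
... | no _     = trans (∧-identityʳ _) (trans (cong (adj G i j ∧_) (Graph.sym G j i)) (∧-idem (adj G i j)))

maxDeg? : (G : Graph n) (D : ℕ) → Dec (MaxDeg G D)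
maxDeg? G D = all? λ v → deg G v ≤? D

countM-cong : (t : ℕ) (G H : Graph n) → G ≈ᴳ H → countM t G ≡ countM t H
countM-cong t G H G≈H = cong (λ es → length (filterᵇ pairwiseDisjoint (choose t es))) (edges-cong G H G≈H)

emptyGraph : ∀ n → Graph n
emptyGraph n = record { adj = λ _ _ → false ; sym = λ _ _ → refl ; irref = λ _ → refl }

emptyGraph-maxDeg : ∀ n D → MaxDeg (emptyGraph n) D
emptyGraph-maxDeg n D v = subst (_≤ D) (sym (length-filterᵇ-false (allFin n))) z≤n

module Extremal (n D t : ℕ) where

  -- The suc ranks every graph of maximum degree at most D above all other graphs.
  score : Graph n → ℕ
  score G with maxDeg? G D
  ... | yes _ = suc (countM t G)
  ... | no  _ = 0

  score-cong : (G H : Graph n) → G ≈ᴳ H → score G ≡ score H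
  score-cong G H G≈H with maxDeg? G D | maxDeg? H D
  ... | yes _ | yes _ = cong suc (countM-cong t G H G≈H)
  ... | no  _ | no  _ = refl
  ... | yes G-ok | no H-bad = ⊥-elim (H-bad λ v → subst (_≤ D) (deg-cong G H G≈H v) (G-ok v))
  ... | no G-bad | yes H-ok = ⊥-elim (G-bad λ v → subst (_≤ D) (sym (deg-cong G H G≈H v)) (H-ok v))

  score-maxDeg : (G : Graph n) → MaxDeg G D → score G ≡ suc (countM t G)
  score-maxDeg G maxdeg with maxDeg? G D
  ... | yes _       = refl
  ... | no  ¬maxdeg = ⊥-elim (¬maxdeg maxdeg)

  positive-score : (G : Graph n) → 1 ≤ score G → MaxDeg G D
  positive-score G pos with maxDeg? G D
  ... | yes maxdeg = maxdeg

  best = Π-hasMaximum (λ _ _ → refl) (λ _ _ eq j → sym (eq j))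
           (Π-hasMaximum (λ _ → refl) (λ _ _ → sym) Bool-hasMaximum n) n
           (score ∘ toGraph) (λ F F′ F≡F′ → score-cong (toGraph F) (toGraph F′) (toGraph-cong F F′ F≡F′))

  extremal : Graph n
  extremal = toGraph (proj₁ best)

  score≤ : (G : Graph n) → score G ≤ score extremal
  score≤ G = ≤-trans (≤-reflexive (score-cong G (toGraph (adj G)) (λ i j → sym (toGraph-adj G i j)))) (proj₂ best (adj G))

  extremal-maxDeg : MaxDeg extremal D
  extremal-maxDeg = positive-score extremal
    (≤-trans (s≤s z≤n) (≤-trans (≤-reflexive (sym (score-maxDeg (emptyGraph n) (emptyGraph-maxDeg n D))))
                                (score≤ (emptyGraph n))))

  extremal-maximum : (G : Graph n) → MaxDeg G D → countM t G ≤ countM t extremal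
  extremal-maximum G maxdeg = ≤-pred (≤-trans (≤-reflexive (sym (score-maxDeg G maxdeg)))
    (≤-trans (score≤ G) (≤-reflexive (score-maxDeg extremal extremal-maxDeg))))

extremal-almostRegular : ∀ D s n → threshold D s ≤ n →
  Σ (Graph n) λ G → (AlmostRegular G D × IsEx n (suc s) (suc D) (countM (suc s) G))
extremal-almostRegular D s n large =
  G* , regular (almostRegular? G* D) , (G* , maxDeg⇒starFree G* extremal-maxDeg , refl) ,
  λ G → extremal-maximum G ∘ starFree⇒maxDeg G
  where
  open Extremal n D (suc s)
  G* = extremal
  K = gainFactor D s
  c* = matchings (suc s) (edges G*)
  no-gain : ¬ (Σ[ H ∈ Graph n ] (MaxDeg H D × K * c* + n ^ s ≤ K * matchings (suc s) (edges H)))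
  no-gain (H , maxdeg-H , gain) = 1+n≰n (+-cancelˡ-≤ (K * c*) 1 0
    (≤-trans (+-monoʳ-≤ (K * c*) 1≤n^s)
    (≤-trans gain (≤-trans (*-monoʳ-≤ K H≤G*) (≤-reflexive (sym (+-identityʳ (K * c*))))))))
    where
    H≤G* : matchings (suc s) (edges H) ≤ c*
    H≤G* = subst₂ _≤_ (countM≡matchings (suc s) H) (countM≡matchings (suc s) G*) (extremal-maximum H maxdeg-H)
    1≤n^s : 1 ≤ n ^ s
    1≤n^s = ≤-trans (≤-reflexive (sym (^-zeroˡ s))) (^-monoˡ-≤ s (≤-trans (s≤s z≤n) large))
  regular : Dec (AlmostRegular G* D) → AlmostRegular G* D
  regular (yes regular) = regular
  regular (no irregular) = ⊥-elim (no-gain (irregular-improvable D s n large G* extremal-maxDeg irregular))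

irregular-suboptimal : ∀ D s n → threshold D s ≤ n → ∀ m → IsEx n (suc s) (suc D) m →
  (G : Graph n) → StarFree (suc D) G → ¬ AlmostRegular G D →
  gainFactor D s * countM (suc s) G + n ^ s ≤ gainFactor D s * m
irregular-suboptimal D s n large m (_ , maximal) G starFree irregular =
  improved (irregular-improvable D s n large G (starFree⇒maxDeg G starFree) irregular)
  where
  K = gainFactor D s
  improved : Σ[ H ∈ Graph n ] (MaxDeg H D × K * matchings (suc s) (edges G) + n ^ s ≤ K * matchings (suc s) (edges H)) →
    K * countM (suc s) G + n ^ s ≤ K * m
  improved (H , maxdeg-H , gain) = begin
    K * countM (suc s) G + n ^ s          ≡⟨ cong (λ c → K * c + n ^ s) (countM≡matchings (suc s) G) ⟩
    K * matchings (suc s) (edges G) + n ^ s ≤⟨ gain ⟩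
    K * matchings (suc s) (edges H)       ≡⟨ cong (K *_) (countM≡matchings (suc s) H) ⟨
    K * countM (suc s) H                  ≤⟨ *-monoʳ-≤ K (maximal H (maxDeg⇒starFree H maxdeg-H)) ⟩
    K * m                                 ∎
    where open ≤-Reasoning

mainTheorem5 : ∀ (t r : ℕ) → 1 ≤ t → 1 ≤ r →
    (∃[ N₀ ] ∀ n → N₀ ≤ n →
       Σ (Graph n) λ G → (AlmostRegular G (r ∸ 1) × IsEx n t r (countM t G)))
    × (∃[ k ] (1 ≤ k × ∃[ N₀ ] ∀ n → N₀ ≤ n → ∀ m → IsEx n t r m →
         ∀ (G' : Graph n) → StarFree r G' → ¬ AlmostRegular G' (r ∸ 1) →
         k * countM t G' + n ^ (t ∸ 1) ≤ k * m))
mainTheorem5 zero    _       () _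
mainTheorem5 (suc s) zero    _  ()
mainTheorem5 (suc s) (suc D) _  _ =
    (threshold D s , extremal-almostRegular D s)
  , (gainFactor D s , 1≤gainFactor D s , threshold D s , irregular-suboptimal D s)
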